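{- Let $q=p^m$ be a power of a prime $p$, let $n,r,s$ be positive integers such that $s\mid n$ and $d:=(n,r)=(s,r)$, and let $c\in\mathbb{F}_{q^s}$ satisfy $N_{q^s|q^d}(c)=1$. Then the binomial $L_{c,r}(x):=x^{q^r}-cx\in\mathbb{F}_{q^n}[x]$ induces a permutation of $\ker(T_{q^n|q^s})$ if and only if $p\nmid n/s$. In this case a polynomial inducing the inverse map of $L_{c,r}$ restricted to $\ker(T_{q^n|q^s})$ is \[\sum_{j=0}^{\frac{s}{d}-1}c^{ -\frac{q^{(j+1)r}-1}{q^r-1}}\left(\left(\frac{n}{s}\right)^{ -1}\sum_{k=1}^{\frac{n}{s}-1}k\,x^{q^{\frac{ksr}{d}}}\right)^{q^{jr}}.\]
   Context: For a prime power $Q$ and positive integers $b\mid a$, $T_{Q^a|Q^b}(x)=\sum_{i=0}^{a/b-1}x^{Q^{ib}}$ is the trace map $\mathbb{F}_{Q^a}\to\mathbb{F}_{Q^b}$ and $N_{Q^a|Q^b}(x)=x^{(Q^a-1)/(Q^b-1)}$ the norm map. $\ker(T_{q^n|q^s})\subseteq\mathbb{F}_{q^n}$ is the kernel of the trace. Integers such as $n/s$ and $k$ are viewed as elements of the prime field $\mathbb{F}_p$, and $(n/s)^{ -1}$ is the inverse there. -}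

module Defs where

open import Level using (Level; _⊔_) renaming (suc to lsuc)
open import Data.Nat as ℕ using (ℕ; zero; suc; _∸_)
open import Data.Nat.DivMod using (_/_)
open import Data.Fin using (Fin)
open import Data.Product using (Σ; _×_; ∃)
open import Relation.Nullary using (¬_)
open import Relation.Binary.PropositionalEquality using (_≡_)
open import Algebra.Bundles using (CommutativeRing)

-- Exact natural division a / b, with the (irrelevant) convention a / 0 = 0.
-- Used only for divisions that are exact and have nonzero divisor in the theorem.
_div_ : ℕ → ℕ → ℕ
a div zero    = 0
a div (suc b) = a / suc b

record FiniteField (a ℓ : Level) (N : ℕ) : Set (lsuc (a ⊔ ℓ)) where
  field
    commRing : CommutativeRing a ℓ
  open CommutativeRing commRing public
  field
    _⁻¹      : Carrier → Carrier
    1≉0      : ¬ (1# ≈ 0#)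
    ⁻¹-inverse : ∀ x → ¬ (x ≈ 0#) → (x * (x ⁻¹)) ≈ 1#
    enum     : Fin N → Carrier
    enum-inj : ∀ i j → enum i ≈ enum j → i ≡ j
    enum-surj : ∀ x → ∃ λ i → enum i ≈ x

module _ {a ℓ : Level} {N : ℕ} (F : FiniteField a ℓ N) where
  open FiniteField F

  pow : Carrier → ℕ → Carrier
  pow x zero    = 1#
  pow x (suc k) = x * pow x k

  natF : ℕ → Carrier
  natF zero    = 0#
  natF (suc k) = 1# + natF k

  sumF : ℕ → (ℕ → Carrier) → Carrier
  sumF zero    f = 0#
  sumF (suc k) f = sumF k f + f k

  trace : (q n s : ℕ) → Carrier → Carrier
  trace q n s x = sumF (n div s) (λ i → pow x (q ℕ.^ (i ℕ.* s)))

  InKer : (q n s : ℕ) → Carrier → Set ℓ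
  InKer q n s x = trace q n s x ≈ 0#

  norm : (q s d : ℕ) → Carrier → Carrier
  norm q s d x = pow x ((q ℕ.^ s ∸ 1) div (q ℕ.^ d ∸ 1))

  Lbin : (q r : ℕ) → Carrier → Carrier → Carrier
  Lbin q r c x = pow x (q ℕ.^ r) - c * x

  PermutesOn : (Carrier → Carrier) → (Carrier → Set ℓ) → Set (a ⊔ ℓ)
  PermutesOn f P =
    (∀ x → P x → P (f x)) ×
    (∀ x y → P x → P y → f x ≈ f y → x ≈ y) ×
    (∀ y → P y → Σ Carrier λ x → P x × (f x ≈ y))

  invPoly : (q n r s d : ℕ) → Carrier → Carrier → Carrier
  invPoly q n r s d c x =
    sumF (s div d) (λ j →
      pow (c ⁻¹) ((q ℕ.^ (suc j ℕ.* r) ∸ 1) div (q ℕ.^ r ∸ 1)) *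
      pow ((natF (n div s)) ⁻¹ *
           sumF (n div s ∸ 1) (λ i →
             natF (suc i) * pow x (q ℕ.^ ((suc i ℕ.* s ℕ.* r) div d))))
          (q ℕ.^ (j ℕ.* r)))

{-# OPTIONS --safe #-}
-- Write t = n/s, e = s/d, Φ(z) = z^(q^(er)) and γⱼ = c^(-(q^((j+1)r) - 1)/(q^r - 1)).  The coefficients
-- satisfy c γⱼ₊₁ = γⱼ^(q^r), c γ₀ = 1 and, by the norm condition, γₑ₋₁ = 1; so A(z) = Σ_{j<e} γⱼ z^(q^(jr))
-- satisfies L∘A = A∘L = Φ - id by telescoping.  As gcd(t, r/d) = 1, the maps Φᵏ (k < t) are the summands of
-- the trace T in another order, and summation by parts gives Φ∘H - H = t·id - T for
-- H(y) = Σ_{k<t} k y^(q^(ker)).  If p ∤ t, then A∘(t⁻¹H) inverts L on ker T (all these additive polynomials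
-- have coefficients in F_{q^s}, hence commute with T).  If p ∣ t, every T(w) lies in ker T and is fixed by
-- Φ, so L(A(T w)) = 0 = L(0); injectivity would make the polynomial A∘T of degree < q^n vanish identically,
-- although its coefficient of x is γ₀ = c⁻¹ ≠ 0.
module Submission where

open import Defs
open import Level using (Level)
open import Data.Nat using (ℕ; _^_; _≤_)
open import Data.Nat.GCD using (gcd)
open import Data.Nat.Divisibility using (_∣_)
open import Data.Nat.Primality using (Prime)
open import Data.Product using (_×_; _,_)
open import Relation.Nullary using (¬_)
open import Relation.Binary.PropositionalEquality using (_≡_)
open import Function.Bundles using (_⇔_; mk⇔)
open import Algebra.Bundles using (CommutativeMonoid; CommutativeRing)

module NatProperties where

  open import Data.Nat
  open import Data.Nat.Properties
  open import Data.Nat.Divisibility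
  open import Data.Nat.DivMod hiding (_div_)
  open import Data.Nat.Primality
  open import Data.Nat.Coprimality using (Coprime; coprime-divisor)
  open import Data.Nat.Combinatorics using (_C_; k![n∸k]!∣n!)
  open import Data.Nat.Combinatorics.Specification using (nCk≡n!/k![n-k]!)
  open import Data.Sum using (inj₁; inj₂)
  open import Data.Empty using (⊥-elim)
  open import Relation.Nullary using (¬_)
  open import Relation.Binary.PropositionalEquality
  open ≡-Reasoning

  prime>1 : ∀ {p} → Prime p → 1 < p
  prime>1 {p} pp = nonTrivial⇒n>1 p {{prime⇒nonTrivial pp}}

  prime∤m! : ∀ {p} → Prime p → ∀ m → m < p → ¬ (p ∣ m !)
  prime∤m! pp zero m<p p∣1 with ∣1⇒≡1 p∣1
  ... | refl = nonTrivial⇒≢1 {{prime⇒nonTrivial pp}} refl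
  prime∤m! pp (suc m) m<p p∣ with euclidsLemma (suc m) (m !) pp p∣
  ... | inj₁ p∣1+m = <⇒≱ m<p (∣⇒≤ p∣1+m)
  ... | inj₂ p∣m!  = prime∤m! pp m (<-trans (n<1+n m) m<p) p∣m!

  n!≡nCk*[k!*[n∸k]!] : ∀ n k → k ≤ n → n ! ≡ (n C k) * (k ! * (n ∸ k) !)
  n!≡nCk*[k!*[n∸k]!] n k k≤n = begin
    n !                                                       ≡⟨ m/n*n≡m {{k !* (n ∸ k) !≢0}} (k![n∸k]!∣n! k≤n) ⟨
    (n ! / (k ! * (n ∸ k) !)) {{k !* (n ∸ k) !≢0}} * (k ! * (n ∸ k) !) ≡⟨ cong (_* (k ! * (n ∸ k) !)) (nCk≡n!/k![n-k]! k≤n) ⟨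
    (n C k) * (k ! * (n ∸ k) !)                               ∎

  prime∣pCk : ∀ {p} → Prime p → ∀ k → 0 < k → k < p → p ∣ p C k
  prime∣pCk {p@(suc p′)} pp k 0<k k<p
    with euclidsLemma (p C k) (k ! * (p ∸ k) !) pp
           (subst (p ∣_) (n!≡nCk*[k!*[n∸k]!] p k (<⇒≤ k<p)) (m∣m*n (p′ !)))
  ... | inj₁ p∣pCk = p∣pCk
  ... | inj₂ p∣k!*[p∸k]! with euclidsLemma (k !) ((p ∸ k) !) pp p∣k!*[p∸k]!
  ...   | inj₁ p∣k!     = ⊥-elim (prime∤m! pp k k<p p∣k!)
  ...   | inj₂ p∣[p∸k]! = ⊥-elim (prime∤m! pp (p ∸ k) (∸-monoʳ-< 0<k (<⇒≤ k<p)) p∣[p∸k]!)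

  div-exact : ∀ m n → 0 < n → n ∣ m → m ≡ (m div n) * n
  div-exact m (suc n) _ n∣m = sym (m/n*n≡m n∣m)

  div-unique : ∀ m n k → 0 < n → m ≡ k * n → m div n ≡ k
  div-unique m (suc n) k _ refl = m*n/n≡m k (suc n)

  ∣∧<⇒≡0 : ∀ {k x} → k ∣ x → x < k → x ≡ 0
  ∣∧<⇒≡0 {x = zero}  _   _   = refl
  ∣∧<⇒≡0 {x = suc x} k∣x x<k = ⊥-elim (<⇒≱ x<k (∣⇒≤ k∣x))

  private
    *-mod-injective-≤ : ∀ {a k} .{{_ : NonZero k}} → Coprime k a →
      ∀ i j → i ≤ j → j < k → (i * a) % k ≡ (j * a) % k → i ≡ j
    *-mod-injective-≤ {a} {k} cop i j i≤j j<k eq =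
      ≤-antisym i≤j (m∸n≡0⇒m≤n (∣∧<⇒≡0 k∣j∸i (≤-trans (s≤s (m∸n≤m j i)) j<k)))
      where
      [j∸i]*a≡[j*a/k∸i*a/k]*k : (j ∸ i) * a ≡ ((j * a) / k ∸ (i * a) / k) * k
      [j∸i]*a≡[j*a/k∸i*a/k]*k = begin
        (j ∸ i) * a                                         ≡⟨ *-distribʳ-∸ a j i ⟩
        j * a ∸ i * a                                       ≡⟨ cong₂ _∸_ (trans (m≡m%n+[m/n]*n (j * a) k) (cong (_+ _) (sym eq)))
                                                                          (m≡m%n+[m/n]*n (i * a) k) ⟩
        ((i * a) % k + (j * a) / k * k) ∸ ((i * a) % k + (i * a) / k * k) ≡⟨ [m+n]∸[m+o]≡n∸o ((i * a) % k) _ _ ⟩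
        (j * a) / k * k ∸ (i * a) / k * k                   ≡⟨ *-distribʳ-∸ k ((j * a) / k) ((i * a) / k) ⟨
        ((j * a) / k ∸ (i * a) / k) * k                     ∎
      k∣j∸i : k ∣ j ∸ i
      k∣j∸i = coprime-divisor cop
        (subst (k ∣_) (trans (sym [j∸i]*a≡[j*a/k∸i*a/k]*k) (*-comm (j ∸ i) a)) (n∣m*n ((j * a) / k ∸ (i * a) / k)))

  *-mod-injective : ∀ {a k} .{{_ : NonZero k}} → Coprime k a →
    ∀ i j → i < k → j < k → (i * a) % k ≡ (j * a) % k → i ≡ j
  *-mod-injective cop i j i<k j<k eq with ≤-total i j
  ... | inj₁ i≤j = *-mod-injective-≤ cop i j i≤j j<k eq
  ... | inj₂ j≤i = sym (*-mod-injective-≤ cop j i j≤i i<k (sym eq))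

  sumℕ : ℕ → (ℕ → ℕ) → ℕ
  sumℕ zero    f = 0
  sumℕ (suc k) f = sumℕ k f + f k

  sumℕ-cons : ∀ k f → sumℕ (suc k) f ≡ f 0 + sumℕ k (λ i → f (suc i))
  sumℕ-cons zero    f = sym (+-identityʳ (f 0))
  sumℕ-cons (suc k) f = trans (cong (_+ f (suc k)) (sumℕ-cons k f)) (+-assoc (f 0) _ _)

  *-distribˡ-sumℕ : ∀ k c f → c * sumℕ k f ≡ sumℕ k (λ i → c * f i)
  *-distribˡ-sumℕ zero    c f = *-zeroʳ c
  *-distribˡ-sumℕ (suc k) c f =
    trans (*-distribˡ-+ c (sumℕ k f) (f k)) (cong (_+ c * f k) (*-distribˡ-sumℕ k c f))

  geometric-sum : ∀ b k → sumℕ k (λ i → suc b ^ i) * b + 1 ≡ suc b ^ k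
  geometric-sum b zero    = refl
  geometric-sum b (suc k) = begin
    (S + B) * b + 1     ≡⟨ cong (_+ 1) (*-distribʳ-+ b S B) ⟩
    S * b + B * b + 1   ≡⟨ +-assoc (S * b) (B * b) 1 ⟩
    S * b + (B * b + 1) ≡⟨ cong (S * b +_) (+-comm (B * b) 1) ⟩
    S * b + (1 + B * b) ≡⟨ +-assoc (S * b) 1 (B * b) ⟨
    S * b + 1 + B * b   ≡⟨ cong (_+ B * b) (geometric-sum b k) ⟩
    B + B * b           ≡⟨ cong (B +_) (*-comm B b) ⟩
    B + b * B           ∎
    where
    S = sumℕ k (λ i → suc b ^ i)
    B = suc b ^ k

  geometric-sum-div : ∀ B k → 1 < B → (B ^ k ∸ 1) div (B ∸ 1) ≡ sumℕ k (λ i → B ^ i)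
  geometric-sum-div (suc (suc b)) k _ = div-unique _ (suc b) _ (s≤s z≤n)
    (sym (trans (sym (m+n∸n≡m _ 1)) (cong (_∸ 1) (geometric-sum (suc b) k))))
  geometric-sum-div (suc zero) k (s≤s ())

  *-divmod : ∀ m k c .{{_ : NonZero k}} → m * c ≡ (m / k) * (k * c) + (m % k) * c
  *-divmod m k c = begin
    m * c                       ≡⟨ cong (_* c) (m≡m%n+[m/n]*n m k) ⟩
    (m % k + m / k * k) * c     ≡⟨ *-distribʳ-+ c (m % k) (m / k * k) ⟩
    m % k * c + m / k * k * c   ≡⟨ cong (m % k * c +_) (*-assoc (m / k) k c) ⟩
    m % k * c + m / k * (k * c) ≡⟨ +-comm (m % k * c) _ ⟩
    m / k * (k * c) + m % k * c ∎

module Exponents (n r s : ℕ) (n≥1 : 1 ≤ n) (r≥1 : 1 ≤ r) (s≥1 : 1 ≤ s) (s∣n : s ∣ n)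
                 (gcd≡ : gcd n r ≡ gcd s r) where

  open import Data.Nat
  open import Data.Nat.Properties
  open import Data.Nat.Divisibility
  open import Data.Nat.GCD
  open import Data.Nat.Coprimality using (Coprime; coprime-divisor)
  open import Data.Sum using (inj₂)
  open import Data.Product using (_,_)
  open import Data.Empty using (⊥-elim)
  open import Relation.Binary.PropositionalEquality
  open ≡-Reasoning
  open NatProperties

  d = gcd n r
  e = s div d
  r′ = r div d
  t = n div s

  d>0 : 0 < d
  d>0 = n≢0⇒n>0 (gcd[m,n]≢0 n r (inj₂ (m<n⇒n≢0 r≥1)))

  instance
    d≢0 : NonZero d
    d≢0 = >-nonZero d>0

  s≡e*d : s ≡ e * d
  s≡e*d = div-exact s d d>0 (subst (_∣ s) (sym gcd≡) (gcd[m,n]∣m s r))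

  r≡r′*d : r ≡ r′ * d
  r≡r′*d = div-exact r d d>0 (gcd[m,n]∣n n r)

  n≡t*s : n ≡ t * s
  n≡t*s = div-exact n s s≥1 s∣n

  private
    >0-factor : ∀ {a b c} → 0 < a → a ≡ b * c → 0 < b
    >0-factor {b = zero}  a>0 a≡0 = ⊥-elim (<⇒≢ a>0 (sym a≡0))
    >0-factor {b = suc b} _   _   = s≤s z≤n

  e>0 : 0 < e
  e>0 = >0-factor s≥1 s≡e*d

  t>0 : 0 < t
  t>0 = >0-factor n≥1 n≡t*s

  instance
    e≢0 : NonZero e
    e≢0 = >-nonZero e>0
    t≢0 : NonZero t
    t≢0 = >-nonZero t>0
    n≢0 : NonZero n
    n≢0 = >-nonZero n≥1

  private
    g*d∣d⇒g≡1 : ∀ g → g * d ∣ d → g ≡ 1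
    g*d∣d⇒g≡1 g gd∣d = *-cancelʳ-≡ g 1 d
      (trans (∣-antisym gd∣d (subst (d ∣_) (*-comm d g) (m∣m*n g))) (sym (*-identityˡ d)))

    g∣r′⇒g*d∣r : ∀ g → g ∣ r′ → g * d ∣ r
    g∣r′⇒g*d∣r g g∣r′ = subst (g * d ∣_) (sym r≡r′*d) (*-monoˡ-∣ d g∣r′)

  coprime-t-r′ : Coprime t r′
  coprime-t-r′ {g} (g∣t , g∣r′) = g*d∣d⇒g≡1 g (gcd-greatest g*d∣n (g∣r′⇒g*d∣r g g∣r′))
    where
    g*d∣n : g * d ∣ n
    g*d∣n = subst (g * d ∣_) (sym (trans n≡t*s (trans (cong (t *_) s≡e*d) (sym (*-assoc t e d)))))
                   (*-monoˡ-∣ d (∣m⇒∣m*n e g∣t))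

  coprime-e-r′ : Coprime e r′
  coprime-e-r′ {g} (g∣e , g∣r′) =
    g*d∣d⇒g≡1 g (subst (g * d ∣_) (sym gcd≡) (gcd-greatest g*d∣s (g∣r′⇒g*d∣r g g∣r′)))
    where
    g*d∣s : g * d ∣ s
    g*d∣s = subst (g * d ∣_) (sym s≡e*d) (*-monoˡ-∣ d g∣e)

  e*r≡r′*s : e * r ≡ r′ * s
  e*r≡r′*s = begin
    e * r        ≡⟨ cong (e *_) r≡r′*d ⟩
    e * (r′ * d) ≡⟨ *-assoc e r′ d ⟨
    e * r′ * d   ≡⟨ cong (_* d) (*-comm e r′) ⟩
    r′ * e * d   ≡⟨ *-assoc r′ e d ⟩
    r′ * (e * d) ≡⟨ cong (r′ *_) s≡e*d ⟨
    r′ * s       ∎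

  t*[e*r]≡r′*n : t * (e * r) ≡ r′ * n
  t*[e*r]≡r′*n = begin
    t * (e * r)  ≡⟨ cong (t *_) e*r≡r′*s ⟩
    t * (r′ * s) ≡⟨ *-assoc t r′ s ⟨
    t * r′ * s   ≡⟨ cong (_* s) (*-comm t r′) ⟩
    r′ * t * s   ≡⟨ *-assoc r′ t s ⟩
    r′ * (t * s) ≡⟨ cong (r′ *_) n≡t*s ⟨
    r′ * n       ∎

  [k*s*r]div-d≡k*[e*r] : ∀ k → (k * s * r) div d ≡ k * (e * r)
  [k*s*r]div-d≡k*[e*r] k = div-unique _ d _ d>0 (begin
    k * s * r         ≡⟨ cong (λ x → k * x * r) s≡e*d ⟩
    k * (e * d) * r   ≡⟨ cong (_* r) (*-assoc k e d) ⟨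
    k * e * d * r     ≡⟨ *-assoc (k * e) d r ⟩
    k * e * (d * r)   ≡⟨ cong (k * e *_) (*-comm d r) ⟩
    k * e * (r * d)   ≡⟨ *-assoc (k * e) r d ⟨
    k * e * r * d     ≡⟨ cong (_* d) (*-assoc k e r) ⟩
    k * (e * r) * d   ∎)

  j*r+i*s≡0[mod-n]⇒j≡0 : ∀ j i → j < e → n ∣ j * r + i * s → j ≡ 0
  j*r+i*s≡0[mod-n]⇒j≡0 j i j<e n∣ = ∣∧<⇒≡0 (coprime-divisor coprime-e-r′ e∣r′*j) j<e
    where
    s∣j*r : s ∣ j * r
    s∣j*r = ∣m+n∣m⇒∣n (subst (s ∣_) (+-comm (j * r) (i * s)) (∣-trans s∣n n∣)) (n∣m*n i)
    e∣r′*j : e ∣ r′ * j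
    e∣r′*j = *-cancelʳ-∣ d (subst₂ _∣_ s≡e*d
      (trans (cong (j *_) r≡r′*d) (trans (sym (*-assoc j r′ d)) (cong (_* d) (*-comm j r′)))) s∣j*r)

  i*s≡0[mod-n]⇒i≡0 : ∀ i → i < t → n ∣ i * s → i ≡ 0
  i*s≡0[mod-n]⇒i≡0 i i<t n∣i*s = m*n≡0⇒m≡0 i s {{>-nonZero s≥1}} (∣∧<⇒≡0 n∣i*s i*s<n)
    where
    i*s<n : i * s < n
    i*s<n = subst (i * s <_) (sym n≡t*s) (*-monoˡ-< s {{>-nonZero s≥1}} i<t)

module FinPermutation where

  open import Data.Nat using (suc)
  open import Data.Fin as Fin using (Fin)
  import Data.Fin.Properties as FinP
  import Data.Nat.Properties as NP
  open import Data.Fin.Permutation using (Permutation; permutation)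
  open import Data.Product using (∃; _,_; proj₁; proj₂)
  open import Data.Empty using (⊥-elim)
  open import Relation.Nullary using (yes; no)
  open import Relation.Binary.PropositionalEquality

  injective⇒surjective : ∀ {n} (f : Fin n → Fin n) → (∀ i j → f i ≡ f j → i ≡ j) → ∀ y → ∃ λ x → f x ≡ y
  injective⇒surjective {suc n} f f-inj y with FinP.any? (λ x → f x Fin.≟ y)
  ... | yes hit  = hit
  ... | no  miss = ⊥-elim (NP.<-irrefl refl (FinP.injective⇒≤ {f = f∖y} f∖y-injective))
    where
    f∖y : Fin (suc n) → Fin n
    f∖y x = Fin.punchOut {i = y} {j = f x} (λ y≡fx → miss (x , sym y≡fx))
    f∖y-injective : ∀ {x x′} → f∖y x ≡ f∖y x′ → x ≡ x′
    f∖y-injective {x} {x′} eq =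
      f-inj x x′ (FinP.punchOut-injective {i = y} (λ e → miss (x , sym e)) (λ e → miss (x′ , sym e)) eq)

  injective⇒permutation : ∀ {n} (f : Fin n → Fin n) → (∀ i j → f i ≡ f j → i ≡ j) → Permutation n n
  injective⇒permutation f f-inj = permutation f (proj₁ ∘ onto) (proj₂ ∘ onto) (λ x → f-inj _ _ (proj₂ (onto (f x))))
    where
    open import Function.Base using (_∘_)
    onto = injective⇒surjective f f-inj

module BigOperator {c ℓ : Level} (M : CommutativeMonoid c ℓ) where

  open import Data.Nat using (zero; suc; _<_)
  import Data.Nat.Properties as NP
  open import Data.Fin using (Fin; toℕ; fromℕ<)
  import Data.Fin.Properties as FinP
  import Relation.Binary.PropositionalEquality as ≡
  import Algebra.Properties.CommutativeMonoid.Sum as Sum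
  open import Function.Base using (_∘_)
  open CommutativeMonoid M
  open import Relation.Binary.Reasoning.Setoid setoid
  open Sum M using (sum; sum-cong-≋; ∑-permute)
  open FinPermutation using (injective⇒permutation)

  bigop : ℕ → (ℕ → Carrier) → Carrier
  bigop zero    f = ε
  bigop (suc k) f = bigop k f ∙ f k

  bigop-cong : ∀ k {f g} → (∀ i → i < k → f i ≈ g i) → bigop k f ≈ bigop k g
  bigop-cong zero    f≈g = refl
  bigop-cong (suc k) f≈g = ∙-cong (bigop-cong k (λ i i<k → f≈g i (NP.m<n⇒m<1+n i<k))) (f≈g k (NP.n<1+n k))

  bigop-cons : ∀ k f → bigop (suc k) f ≈ f 0 ∙ bigop k (f ∘ suc)
  bigop-cons zero    f = trans (identityˡ _) (sym (identityʳ _))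
  bigop-cons (suc k) f = trans (∙-congʳ (bigop-cons k f)) (assoc _ _ _)

  bigop≈sum : ∀ k f → bigop k f ≈ sum {k} (f ∘ toℕ)
  bigop≈sum zero    f = refl
  bigop≈sum (suc k) f = trans (bigop-cons k f) (∙-congˡ (bigop≈sum k (f ∘ suc)))

  bigop-reindex : ∀ k f (h : ℕ → ℕ) → (∀ i → i < k → h i < k) →
    (∀ i j → i < k → j < k → h i ≡ h j → i ≡ j) → bigop k (f ∘ h) ≈ bigop k f
  bigop-reindex k f h h< h-inj = begin
    bigop k (f ∘ h)             ≈⟨ bigop≈sum k (f ∘ h) ⟩
    sum {k} (f ∘ h ∘ toℕ)       ≈⟨ sum-cong-≋ (λ i → reflexive (≡.cong f (≡.sym (FinP.toℕ-fromℕ< (h<′ i))))) ⟩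
    sum {k} (f ∘ toℕ ∘ σ)       ≈⟨ ∑-permute (f ∘ toℕ) (injective⇒permutation σ σ-injective) ⟨
    sum {k} (f ∘ toℕ)           ≈⟨ bigop≈sum k f ⟨
    bigop k f                   ∎
    where
    h<′ : ∀ (i : Fin k) → h (toℕ i) < k
    h<′ i = h< (toℕ i) (FinP.toℕ<n i)
    σ : Fin k → Fin k
    σ i = fromℕ< (h<′ i)
    σ-injective : ∀ i j → σ i ≡ σ j → i ≡ j
    σ-injective i j eq = FinP.toℕ-injective (h-inj (toℕ i) (toℕ j) (FinP.toℕ<n i) (FinP.toℕ<n j)
      (≡.trans (≡.sym (FinP.toℕ-fromℕ< _)) (≡.trans (≡.cong toℕ eq) (FinP.toℕ-fromℕ< _))))

-- The solver normalises by deciding equality of coefficients.  Decidability of ≈ in a finite field comes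
-- from its enumeration and does not reduce on symbolic terms, so coefficients are taken in ℤ instead.
module IntegerCoefficientSolver {c ℓ : Level} (R : CommutativeRing c ℓ) where

  open import Data.Nat as ℕ using (zero; suc)
  import Data.Nat.Properties as NP
  open import Data.Integer as ℤ using (ℤ; +_; -[1+_])
  import Data.Integer.Properties as ℤP
  open import Data.Sign as Sign using (Sign)
  open import Data.Maybe using (Maybe; just; nothing)
  open import Relation.Nullary using (yes; no)
  import Relation.Binary.PropositionalEquality as ≡
  import Algebra.Solver.Ring.AlmostCommutativeRing as ACR
  open CommutativeRing R
  open import Relation.Binary.Reasoning.Setoid setoid
  open import Algebra.Properties.Ring ring using (-‿distribˡ-*; -‿distribʳ-*; -0#≈0#; -‿involutive; -‿+-comm)
  open import Algebra.Properties.Semiring.Mult semiring using (×-homo-+; ×1-homo-*) renaming (_×_ to _×ₙ_)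

  ⟦_⟧ℤ : ℤ → Carrier
  ⟦ + n      ⟧ℤ = n ×ₙ 1#
  ⟦ -[1+ n ] ⟧ℤ = - (suc n ×ₙ 1#)

  private
    signed : Sign → Carrier → Carrier
    signed Sign.+ x = x
    signed Sign.- x = - x

    signed-cong : ∀ s {x y} → x ≈ y → signed s x ≈ signed s y
    signed-cong Sign.+ x≈y = x≈y
    signed-cong Sign.- x≈y = -‿cong x≈y

    signed-* : ∀ s t x y → signed (s Sign.* t) (x * y) ≈ signed s x * signed t y
    signed-* Sign.+ Sign.+ x y = refl
    signed-* Sign.+ Sign.- x y = -‿distribʳ-* x y
    signed-* Sign.- Sign.+ x y = -‿distribˡ-* x y
    signed-* Sign.- Sign.- x y = begin
      x * y         ≈⟨ -‿involutive _ ⟨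
      - (- (x * y)) ≈⟨ -‿cong (-‿distribˡ-* x y) ⟩
      - (- x * y)   ≈⟨ -‿distribʳ-* (- x) y ⟩
      - x * - y     ∎

    ⟦◃⟧ : ∀ s n → ⟦ s ℤ.◃ n ⟧ℤ ≈ signed s (n ×ₙ 1#)
    ⟦◃⟧ Sign.+ zero    = refl
    ⟦◃⟧ Sign.- zero    = sym -0#≈0#
    ⟦◃⟧ Sign.+ (suc n) = refl
    ⟦◃⟧ Sign.- (suc n) = refl

    ⟦⟧≈signed : ∀ i → ⟦ i ⟧ℤ ≈ signed (ℤ.sign i) (ℤ.∣ i ∣ ×ₙ 1#)
    ⟦⟧≈signed (+ n)    = refl
    ⟦⟧≈signed -[1+ n ] = refl

    ⟦⊖⟧ : ∀ m n → ⟦ m ℤ.⊖ n ⟧ℤ ≈ m ×ₙ 1# - n ×ₙ 1#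
    ⟦⊖⟧ m       zero    = sym (trans (+-congˡ -0#≈0#) (+-identityʳ _))
    ⟦⊖⟧ zero    (suc n) = sym (+-identityˡ _)
    ⟦⊖⟧ (suc m) (suc n) = begin
      ⟦ suc m ℤ.⊖ suc n ⟧ℤ                ≡⟨ ≡.cong ⟦_⟧ℤ (ℤP.[1+m]⊖[1+n]≡m⊖n m n) ⟩
      ⟦ m ℤ.⊖ n ⟧ℤ                         ≈⟨ ⟦⊖⟧ m n ⟩
      M - N                                ≈⟨ +-identityˡ _ ⟨
      0# + (M - N)                         ≈⟨ +-congʳ (-‿inverseʳ 1#) ⟨
      (1# - 1#) + (M - N)                  ≈⟨ +-assoc 1# (- 1#) (M - N) ⟩
      1# + (- 1# + (M - N))                ≈⟨ +-congˡ (+-assoc (- 1#) M (- N)) ⟨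
      1# + ((- 1# + M) - N)                ≈⟨ +-congˡ (+-congʳ (+-comm (- 1#) M)) ⟩
      1# + ((M - 1#) - N)                  ≈⟨ +-congˡ (+-assoc M (- 1#) (- N)) ⟩
      1# + (M + (- 1# - N))                ≈⟨ +-assoc 1# M (- 1# - N) ⟨
      (1# + M) + (- 1# - N)                ≈⟨ +-congˡ (-‿+-comm 1# N) ⟩
      (1# + M) - (1# + N)                  ∎
      where
      M = m ×ₙ 1#
      N = n ×ₙ 1#

  +-homo : ∀ i j → ⟦ i ℤ.+ j ⟧ℤ ≈ ⟦ i ⟧ℤ + ⟦ j ⟧ℤ
  +-homo (+ m)    (+ n)    = ×-homo-+ 1# m n
  +-homo (+ m)    -[1+ n ] = ⟦⊖⟧ m (suc n)
  +-homo -[1+ m ] (+ n)    = trans (⟦⊖⟧ n (suc m)) (+-comm _ _)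
  +-homo -[1+ m ] -[1+ n ] = begin
    - (suc (suc (m ℕ.+ n)) ×ₙ 1#)            ≡⟨ ≡.cong (λ k → - (suc k ×ₙ 1#)) (≡.sym (NP.+-suc m n)) ⟩
    - ((suc m ℕ.+ suc n) ×ₙ 1#)              ≈⟨ -‿cong (×-homo-+ 1# (suc m) (suc n)) ⟩
    - (suc m ×ₙ 1# + suc n ×ₙ 1#)             ≈⟨ -‿+-comm _ _ ⟨
    - (suc m ×ₙ 1#) + - (suc n ×ₙ 1#)         ∎

  *-homo : ∀ i j → ⟦ i ℤ.* j ⟧ℤ ≈ ⟦ i ⟧ℤ * ⟦ j ⟧ℤ
  *-homo i j = begin
    ⟦ σ ℤ.◃ (∣i∣ ℕ.* ∣j∣) ⟧ℤ                                       ≈⟨ ⟦◃⟧ σ (∣i∣ ℕ.* ∣j∣) ⟩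
    signed σ ((∣i∣ ℕ.* ∣j∣) ×ₙ 1#)                                  ≈⟨ signed-cong σ (×1-homo-* ∣i∣ ∣j∣) ⟩
    signed σ (∣i∣ ×ₙ 1# * ∣j∣ ×ₙ 1#)                                ≈⟨ signed-* (ℤ.sign i) (ℤ.sign j) _ _ ⟩
    signed (ℤ.sign i) (∣i∣ ×ₙ 1#) * signed (ℤ.sign j) (∣j∣ ×ₙ 1#)   ≈⟨ *-cong (⟦⟧≈signed i) (⟦⟧≈signed j) ⟨
    ⟦ i ⟧ℤ * ⟦ j ⟧ℤ                                                 ∎
    where
    σ = ℤ.sign i Sign.* ℤ.sign j
    ∣i∣ = ℤ.∣ i ∣
    ∣j∣ = ℤ.∣ j ∣

  -‿homo : ∀ i → ⟦ ℤ.- i ⟧ℤ ≈ - ⟦ i ⟧ℤ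
  -‿homo (+ zero)  = sym -0#≈0#
  -‿homo (+ suc n) = refl
  -‿homo -[1+ n ]  = sym (-‿involutive _)

  ℤ⟶R : CommutativeRing.rawRing ℤP.+-*-commutativeRing ACR.-Raw-AlmostCommutative⟶ ACR.fromCommutativeRing R
  ℤ⟶R = record
    { ⟦_⟧    = ⟦_⟧ℤ
    ; +-homo = +-homo
    ; *-homo = *-homo
    ; -‿homo = -‿homo
    ; 0-homo = refl
    ; 1-homo = +-identityʳ 1#
    }

  ⟦⟧ℤ-weaklyDecidable : ∀ i j → Maybe (⟦ i ⟧ℤ ≈ ⟦ j ⟧ℤ)
  ⟦⟧ℤ-weaklyDecidable i j with i ℤ.≟ j
  ... | yes ≡.refl = just refl
  ... | no  _      = nothing

  open import Algebra.Solver.Ring (CommutativeRing.rawRing ℤP.+-*-commutativeRing) (ACR.fromCommutativeRing R) ℤ⟶R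
    ⟦⟧ℤ-weaklyDecidable public using (solve; _:=_; _:+_; _:*_; _:-_; :-_)

module FieldProperties {a ℓ : Level} {N : ℕ} (F : FiniteField a ℓ N) where

  open import Data.Nat as ℕ using (zero; suc)
  open import Data.Fin as Fin using ()
  open import Data.Product using (_,_)
  open import Data.Empty using (⊥-elim)
  open import Relation.Nullary using (yes; no)
  open import Relation.Binary.Definitions using (Decidable)
  import Relation.Binary.PropositionalEquality as ≡
  open FiniteField F public
  open import Relation.Binary.Reasoning.Setoid setoid public
  open import Algebra.Properties.Ring ring public using (-0#≈0#; -‿+-comm; +-inverseʳ-unique)
  import Algebra.Properties.Semiring.Mult semiring as Mult
  import Algebra.Properties.CommutativeSemiring.Exp commutativeSemiring as Exp
  open Exp using () renaming (_^_ to _^F_)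

  _≟_ : Decidable _≈_
  x ≟ y with enum-surj x | enum-surj y
  ... | i , i↦x | j , j↦y with i Fin.≟ j
  ...   | yes ≡.refl = yes (trans (sym i↦x) j↦y)
  ...   | no  i≢j    = no (λ x≈y → i≢j (enum-inj i j (trans i↦x (trans x≈y (sym j↦y)))))

  open IntegerCoefficientSolver commRing public using (solve; _:=_; _:+_; _:*_; _:-_; :-_)

  natF≡×1# : ∀ k → natF F k ≡ k Mult.× 1#
  natF≡×1# zero    = ≡.refl
  natF≡×1# (suc k) = ≡.cong (1# +_) (natF≡×1# k)

  natF-homo-+ : ∀ m n → natF F (m ℕ.+ n) ≈ natF F m + natF F n
  natF-homo-+ m n
    rewrite natF≡×1# (m ℕ.+ n) | natF≡×1# m | natF≡×1# n = Mult.×-homo-+ 1# m n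

  natF-homo-* : ∀ m n → natF F (m ℕ.* n) ≈ natF F m * natF F n
  natF-homo-* m n
    rewrite natF≡×1# (m ℕ.* n) | natF≡×1# m | natF≡×1# n = Mult.×1-homo-* m n

  pow≡^ : ∀ x k → pow F x k ≡ x ^F k
  pow≡^ x zero    = ≡.refl
  pow≡^ x (suc k) = ≡.cong (x *_) (pow≡^ x k)

  pow-congˡ : ∀ k {x y} → x ≈ y → pow F x k ≈ pow F y k
  pow-congˡ k {x} {y} x≈y rewrite pow≡^ x k | pow≡^ y k = Exp.^-congˡ k x≈y

  pow-homo-+ : ∀ x m n → pow F x (m ℕ.+ n) ≈ pow F x m * pow F x n
  pow-homo-+ x m n rewrite pow≡^ x (m ℕ.+ n) | pow≡^ x m | pow≡^ x n = Exp.^-homo-* x m n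

  pow-assocʳ : ∀ x m n → pow F (pow F x m) n ≈ pow F x (m ℕ.* n)
  pow-assocʳ x m n
    rewrite pow≡^ (pow F x m) n | pow≡^ x m | pow≡^ x (m ℕ.* n) = Exp.^-assocʳ x m n

  pow-distrib-* : ∀ x y k → pow F (x * y) k ≈ pow F x k * pow F y k
  pow-distrib-* x y k
    rewrite pow≡^ (x * y) k | pow≡^ x k | pow≡^ y k = Exp.^-distrib-* x y k

  pow-comm : ∀ x m n → pow F (pow F x m) n ≈ pow F (pow F x n) m
  pow-comm x m n = begin
    pow F (pow F x m) n ≈⟨ pow-assocʳ x m n ⟩
    pow F x (m ℕ.* n)   ≡⟨ ≡.cong (pow F x) (*-comm-ℕ m n) ⟩
    pow F x (n ℕ.* m)   ≈⟨ pow-assocʳ x n m ⟨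
    pow F (pow F x n) m ∎
    where open import Data.Nat.Properties using () renaming (*-comm to *-comm-ℕ)

  pow-1# : ∀ k → pow F 1# k ≈ 1#
  pow-1# zero    = refl
  pow-1# (suc k) = trans (*-identityˡ _) (pow-1# k)

  x≈0⇒pow≈0 : ∀ x k → x ≈ 0# → 0 ℕ.< k → pow F x k ≈ 0#
  x≈0⇒pow≈0 x (suc k) x≈0 _ = trans (*-congʳ x≈0) (zeroˡ _)

  natF-homo-^ : ∀ m k → natF F (m ℕ.^ k) ≈ pow F (natF F m) k
  natF-homo-^ m zero    = +-identityʳ 1#
  natF-homo-^ m (suc k) = trans (natF-homo-* m (m ℕ.^ k)) (*-congˡ (natF-homo-^ m k))

  ⁻¹-inverseˡ : ∀ x → ¬ (x ≈ 0#) → (x ⁻¹) * x ≈ 1#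
  ⁻¹-inverseˡ x x≉0 = trans (*-comm _ _) (⁻¹-inverse x x≉0)

  *-cancelˡ : ∀ x {y z} → ¬ (x ≈ 0#) → x * y ≈ x * z → y ≈ z
  *-cancelˡ x {y} {z} x≉0 xy≈xz = begin
    y                ≈⟨ *-identityˡ y ⟨
    1# * y           ≈⟨ *-congʳ (⁻¹-inverseˡ x x≉0) ⟨
    (x ⁻¹) * x * y   ≈⟨ *-assoc _ _ _ ⟩
    (x ⁻¹) * (x * y) ≈⟨ *-congˡ xy≈xz ⟩
    (x ⁻¹) * (x * z) ≈⟨ *-assoc _ _ _ ⟨
    (x ⁻¹) * x * z   ≈⟨ *-congʳ (⁻¹-inverseˡ x x≉0) ⟩
    1# * z           ≈⟨ *-identityˡ z ⟩
    z                ∎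

  x*y≈0⇒y≈0 : ∀ x y → ¬ (x ≈ 0#) → x * y ≈ 0# → y ≈ 0#
  x*y≈0⇒y≈0 x y x≉0 xy≈0 = *-cancelˡ x x≉0 (trans xy≈0 (sym (zeroʳ x)))

  *-≉0 : ∀ x y → ¬ (x ≈ 0#) → ¬ (y ≈ 0#) → ¬ (x * y ≈ 0#)
  *-≉0 x y x≉0 y≉0 xy≈0 = y≉0 (x*y≈0⇒y≈0 x y x≉0 xy≈0)

  pow-≉0 : ∀ x k → ¬ (x ≈ 0#) → ¬ (pow F x k ≈ 0#)
  pow-≉0 x zero    x≉0 = 1≉0
  pow-≉0 x (suc k) x≉0 = *-≉0 x _ x≉0 (pow-≉0 x k x≉0)

  pow≈0⇒≈0 : ∀ x k → pow F x k ≈ 0# → x ≈ 0#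
  pow≈0⇒≈0 x k xᵏ≈0 with x ≟ 0#
  ... | yes x≈0 = x≈0
  ... | no  x≉0 = ⊥-elim (pow-≉0 x k x≉0 xᵏ≈0)

  ⁻¹-≉0 : ∀ x → ¬ (x ≈ 0#) → ¬ ((x ⁻¹) ≈ 0#)
  ⁻¹-≉0 x x≉0 x⁻¹≈0 = 1≉0 (trans (sym (⁻¹-inverse x x≉0)) (trans (*-congˡ x⁻¹≈0) (zeroʳ x)))

  ⁻¹-unique : ∀ x y → x * y ≈ 1# → y ≈ x ⁻¹
  ⁻¹-unique x y xy≈1 = *-cancelˡ x x≉0 (trans xy≈1 (sym (⁻¹-inverse x x≉0)))
    where
    x≉0 : ¬ (x ≈ 0#)
    x≉0 x≈0 = 1≉0 (trans (sym xy≈1) (trans (*-congʳ x≈0) (zeroˡ y)))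

  ⁻¹-cong : ∀ {x y} → ¬ (x ≈ 0#) → x ≈ y → x ⁻¹ ≈ y ⁻¹
  ⁻¹-cong {x} {y} x≉0 x≈y = ⁻¹-unique y (x ⁻¹) (trans (*-congʳ (sym x≈y)) (⁻¹-inverse x x≉0))

module SumProperties {a ℓ : Level} {N : ℕ} (F : FiniteField a ℓ N) where

  open import Data.Nat as ℕ using (zero; suc; _<_)
  import Data.Nat.Properties as NP
  open import Data.Empty using (⊥-elim)
  open import Relation.Nullary using (yes; no)
  open import Relation.Binary.PropositionalEquality as ≡ using (_≢_)
  open import Function.Base using (_∘_)
  open FieldProperties F
  open NatProperties using (sumℕ)
  module +-BigOp = BigOperator +-commutativeMonoid
  module *-BigOp = BigOperator *-commutativeMonoid

  prodF : ℕ → (ℕ → Carrier) → Carrier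
  prodF = *-BigOp.bigop

  sumF-cong : ∀ k {f g} → (∀ i → i < k → f i ≈ g i) → sumF F k f ≈ sumF F k g
  sumF-cong zero    f≈g = refl
  sumF-cong (suc k) f≈g = +-cong (sumF-cong k (λ i i<k → f≈g i (NP.m<n⇒m<1+n i<k))) (f≈g k (NP.n<1+n k))

  sumF-cong′ : ∀ k {f g} → (∀ i → f i ≈ g i) → sumF F k f ≈ sumF F k g
  sumF-cong′ k f≈g = sumF-cong k (λ i _ → f≈g i)

  sumF≈bigop : ∀ k f → sumF F k f ≈ +-BigOp.bigop k f
  sumF≈bigop zero    f = refl
  sumF≈bigop (suc k) f = +-congʳ (sumF≈bigop k f)

  sumF-cons : ∀ k f → sumF F (suc k) f ≈ f 0 + sumF F k (f ∘ suc)
  sumF-cons k f = begin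
    sumF F (suc k) f             ≈⟨ sumF≈bigop (suc k) f ⟩
    +-BigOp.bigop (suc k) f      ≈⟨ +-BigOp.bigop-cons k f ⟩
    f 0 + +-BigOp.bigop k (f ∘ suc) ≈⟨ +-congˡ (sumF≈bigop k (f ∘ suc)) ⟨
    f 0 + sumF F k (f ∘ suc)     ∎

  sumF-reindex : ∀ k f (h : ℕ → ℕ) → (∀ i → i < k → h i < k) →
    (∀ i j → i < k → j < k → h i ≡ h j → i ≡ j) → sumF F k (f ∘ h) ≈ sumF F k f
  sumF-reindex k f h h< h-inj = begin
    sumF F k (f ∘ h)          ≈⟨ sumF≈bigop k (f ∘ h) ⟩
    +-BigOp.bigop k (f ∘ h)   ≈⟨ +-BigOp.bigop-reindex k f h h< h-inj ⟩
    +-BigOp.bigop k f         ≈⟨ sumF≈bigop k f ⟨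
    sumF F k f                ∎

  sumF-0# : ∀ k → sumF F k (λ _ → 0#) ≈ 0#
  sumF-0# zero    = refl
  sumF-0# (suc k) = trans (+-identityʳ _) (sumF-0# k)

  sumF-distrib-+ : ∀ k f g → sumF F k (λ i → f i + g i) ≈ sumF F k f + sumF F k g
  sumF-distrib-+ zero    f g = sym (+-identityˡ 0#)
  sumF-distrib-+ (suc k) f g = trans (+-congʳ (sumF-distrib-+ k f g))
    (solve 4 (λ a b c d → (a :+ b) :+ (c :+ d) := (a :+ c) :+ (b :+ d)) refl _ _ _ _)

  *-distribˡ-sumF : ∀ k x f → x * sumF F k f ≈ sumF F k (λ i → x * f i)
  *-distribˡ-sumF zero    x f = zeroʳ x
  *-distribˡ-sumF (suc k) x f = trans (distribˡ x _ _) (+-congʳ (*-distribˡ-sumF k x f))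

  -‿distrib-sumF : ∀ k f → - sumF F k f ≈ sumF F k (λ i → - f i)
  -‿distrib-sumF zero    f = -0#≈0#
  -‿distrib-sumF (suc k) f = trans (sym (-‿+-comm _ _)) (+-congʳ (-‿distrib-sumF k f))

  sumF-distrib-− : ∀ k f g → sumF F k (λ i → f i - g i) ≈ sumF F k f - sumF F k g
  sumF-distrib-− k f g = trans (sumF-distrib-+ k f (λ i → - g i)) (+-congˡ (sym (-‿distrib-sumF k g)))

  sumF-comm : ∀ k l (f : ℕ → ℕ → Carrier) →
    sumF F k (λ i → sumF F l (f i)) ≈ sumF F l (λ j → sumF F k (λ i → f i j))
  sumF-comm zero    l f = sym (sumF-0# l)
  sumF-comm (suc k) l f =
    trans (+-congʳ (sumF-comm k l f)) (sym (sumF-distrib-+ l (λ j → sumF F k (λ i → f i j)) (f k)))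

  sumF-const : ∀ k z → sumF F k (λ _ → z) ≈ natF F k * z
  sumF-const zero    z = sym (zeroˡ z)
  sumF-const (suc k) z = begin
    sumF F k (λ _ → z) + z    ≈⟨ +-congʳ (sumF-const k z) ⟩
    natF F k * z + z          ≈⟨ +-congˡ (*-identityˡ z) ⟨
    natF F k * z + 1# * z     ≈⟨ solve 3 (λ o a z → a :* z :+ o :* z := (o :+ a) :* z) refl 1# (natF F k) z ⟩
    (1# + natF F k) * z       ∎

  sumF-rotate : ∀ k (g : ℕ → Carrier) → g k ≈ g 0 → sumF F k (g ∘ suc) ≈ sumF F k g
  sumF-rotate k g gₖ≈g₀ = begin
    sumF F k (g ∘ suc)                   ≈⟨ solve 2 (λ a b → a := (b :+ a) :- b) refl _ (g 0) ⟩
    (g 0 + sumF F k (g ∘ suc)) - g 0     ≈⟨ +-cong (sym (sumF-cons k g)) (-‿cong (sym gₖ≈g₀)) ⟩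
    (sumF F k g + g k) - g k             ≈⟨ solve 2 (λ a b → (a :+ b) :- b := a) refl _ (g k) ⟩
    sumF F k g                           ∎

  additive-sumF : (φ : Carrier → Carrier) → φ 0# ≈ 0# → (∀ x y → φ (x + y) ≈ φ x + φ y) →
    ∀ k f → φ (sumF F k f) ≈ sumF F k (φ ∘ f)
  additive-sumF φ φ0 φ+ zero    f = φ0
  additive-sumF φ φ0 φ+ (suc k) f = trans (φ+ _ _) (+-congʳ (additive-sumF φ φ0 φ+ k f))

  δ : ℕ → ℕ → Carrier → Carrier
  δ i j v with i ℕ.≟ j
  ... | yes _ = v
  ... | no  _ = 0#

  δ-≡ : ∀ i v → δ i i v ≈ v
  δ-≡ i v with i ℕ.≟ i
  ... | yes _  = refl
  ... | no i≢i = ⊥-elim (i≢i ≡.refl)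

  δ-≢ : ∀ i j v → i ≢ j → δ i j v ≈ 0#
  δ-≢ i j v i≢j with i ℕ.≟ j
  ... | yes i≡j = ⊥-elim (i≢j i≡j)
  ... | no  _   = refl

  δ-congʳ : ∀ i j {v w} → v ≈ w → δ i j v ≈ δ i j w
  δ-congʳ i j v≈w with i ℕ.≟ j
  ... | yes _ = v≈w
  ... | no  _ = refl

  δ-0# : ∀ i j → δ i j 0# ≈ 0#
  δ-0# i j with i ℕ.≟ j
  ... | yes _ = refl
  ... | no  _ = refl

  δ-*ʳ : ∀ i j v x → δ i j v * x ≈ δ i j (v * x)
  δ-*ʳ i j v x with i ℕ.≟ j
  ... | yes _ = refl
  ... | no  _ = zeroˡ x

  sumF-δ : ∀ k j (v : ℕ → Carrier) → j < k → sumF F k (λ i → δ i j (v i)) ≈ v j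
  sumF-δ (suc k) j v j<1+k with j ℕ.≟ k
  ... | yes ≡.refl = trans (+-cong (trans (sumF-cong k (λ i i<j → δ-≢ i j (v i) (λ i≡j → NP.<-irrefl i≡j i<j)))
                                          (sumF-0# k))
                                   (δ-≡ j (v j)))
                           (+-identityˡ _)
  ... | no  j≢k    = trans (+-cong (sumF-δ k j v (NP.≤∧≢⇒< (NP.≤-pred j<1+k) j≢k)) (δ-≢ k j (v k) (j≢k ∘ ≡.sym)))
                           (+-identityʳ _)

  pow-sumℕ : ∀ x k f → pow F x (sumℕ k f) ≈ prodF k (pow F x ∘ f)
  pow-sumℕ x zero    f = refl
  pow-sumℕ x (suc k) f = trans (pow-homo-+ x (sumℕ k f) (f k)) (*-congʳ (pow-sumℕ x k f))

  sumF-by-parts : ∀ M (α : ℕ → Carrier) →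
    sumF F M (λ i → natF F (suc i) * α (suc (suc i))) - sumF F M (λ i → natF F (suc i) * α (suc i))
      ≈ natF F M * α (suc M) - sumF F M (α ∘ suc)
  sumF-by-parts zero    α = trans (-‿inverseʳ 0#) (sym (trans (+-cong (zeroˡ _) -0#≈0#) (+-identityʳ 0#)))
  sumF-by-parts (suc M) α = begin
    (S₂ + (1# + n) * a₂) - (S₁ + (1# + n) * a₁)
      ≈⟨ solve 6 (λ S₂ S₁ n a₁ a₂ o → (S₂ :+ (o :+ n) :* a₂) :- (S₁ :+ (o :+ n) :* a₁)
                                    := (S₂ :- S₁) :+ ((o :+ n) :* a₂ :- (o :+ n) :* a₁)) refl S₂ S₁ n a₁ a₂ 1# ⟩
    (S₂ - S₁) + ((1# + n) * a₂ - (1# + n) * a₁)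
      ≈⟨ +-congʳ (sumF-by-parts M α) ⟩
    (n * a₁ - S) + ((1# + n) * a₂ - (1# + n) * a₁)
      ≈⟨ solve 5 (λ S n a₁ a₂ o → (n :* a₁ :- S) :+ ((o :+ n) :* a₂ :- (o :+ n) :* a₁)
                                := (o :+ n) :* a₂ :- (S :+ o :* a₁)) refl S n a₁ a₂ 1# ⟩
    (1# + n) * a₂ - (S + 1# * a₁)
      ≈⟨ +-congˡ (-‿cong (+-congˡ (*-identityˡ a₁))) ⟩
    (1# + n) * a₂ - (S + a₁) ∎
    where
    n  = natF F M
    a₁ = α (suc M)
    a₂ = α (suc (suc M))
    S₁ = sumF F M (λ i → natF F (suc i) * α (suc i))
    S₂ = sumF F M (λ i → natF F (suc i) * α (suc (suc i)))
    S  = sumF F M (α ∘ suc)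

module FiniteFieldCounting {a ℓ : Level} {N : ℕ} (F : FiniteField a ℓ N) where

  open import Data.Nat as ℕ using (zero; suc)
  import Data.Nat.Properties as NP
  open import Data.Fin as Fin using (Fin)
  import Data.Fin.Properties as FinP
  open import Data.Fin.Permutation using (Permutation; permutation)
  open import Data.Product using (_,_; proj₁; proj₂)
  open import Data.Empty using (⊥-elim)
  open import Relation.Nullary using (yes; no)
  open import Relation.Binary.PropositionalEquality using (_≢_)
  import Algebra.Properties.CommutativeMonoid.Sum as Sum
  open import Function.Base using (_∘_)
  open FieldProperties F
  module +-Sum = Sum +-commutativeMonoid
  module *-Sum = Sum *-commutativeMonoid

  ∑-enum-bijection : ∀ {c ℓ′} (M : CommutativeMonoid c ℓ′) (let module M = CommutativeMonoid M)
    (φ : Carrier → M.Carrier) → (∀ {x y} → x ≈ y → φ x M.≈ φ y) →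
    (g h : Carrier → Carrier) → (∀ {x y} → x ≈ y → g x ≈ g y) → (∀ {x y} → x ≈ y → h x ≈ h y) →
    (∀ y → g (h y) ≈ y) → (∀ y → h (g y) ≈ y) →
    Sum.sum M (φ ∘ enum) M.≈ Sum.sum M (φ ∘ g ∘ enum)
  ∑-enum-bijection M φ φ-cong g h g-cong h-cong gh hg =
    M.trans (Sum.∑-permute M (φ ∘ enum) π) (Sum.sum-cong-≋ M (λ i → φ-cong (proj₂ (enum-surj (g (enum i))))))
    where
    module M = CommutativeMonoid M
    index : Carrier → Fin N
    index x = proj₁ (enum-surj x)
    π : Permutation N N
    π = permutation (index ∘ g ∘ enum) (index ∘ h ∘ enum)
      (λ i → enum-inj _ _ (trans (proj₂ (enum-surj _)) (trans (g-cong (proj₂ (enum-surj _))) (gh _))))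
      (λ i → enum-inj _ _ (trans (proj₂ (enum-surj _)) (trans (h-cong (proj₂ (enum-surj _))) (hg _))))

  -- Translation by 1 permutes F, so Σ (1 + x) = Σ x.
  natF[N]≈0 : natF F N ≈ 0#
  natF[N]≈0 = begin
    natF F N                                   ≈⟨ *-identityʳ _ ⟨
    natF F N * 1#                              ≈⟨ solve 2 (λ n s → n := (n :+ s) :- s) refl _ S ⟩
    (natF F N * 1# + S) - S                    ≈⟨ +-congʳ (+-congʳ (sumF-const-1 N)) ⟨
    (+-Sum.sum {N} (λ _ → 1#) + S) - S         ≈⟨ +-congʳ (+-Sum.∑-distrib-+ (λ _ → 1#) enum) ⟨
    +-Sum.sum (λ i → 1# + enum i) - S          ≈⟨ +-congʳ (∑-enum-bijection +-commutativeMonoid (λ y → y) (λ y≈z → y≈z)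
                                                    (1# +_) (- 1# +_) +-congˡ +-congˡ
                                                    (solve 2 (λ o y → o :+ (:- o :+ y) := y) refl 1#)
                                                    (solve 2 (λ o y → :- o :+ (o :+ y) := y) refl 1#)) ⟨
    S - S                                      ≈⟨ -‿inverseʳ S ⟩
    0#                                         ∎
    where
    S = +-Sum.sum enum
    sumF-const-1 : ∀ k → +-Sum.sum {k} (λ _ → 1#) ≈ natF F k * 1#
    sumF-const-1 zero    = sym (zeroˡ 1#)
    sumF-const-1 (suc k) = trans (+-congˡ (sumF-const-1 k)) (trans (+-congʳ (sym (*-identityˡ 1#))) (sym (distribʳ 1# 1# _)))

  private
    nonzero-or-1 : Carrier → Carrier
    nonzero-or-1 y with y ≟ 0#
    ... | yes _ = 1#
    ... | no  _ = y

    nonzero-or-1-cong : ∀ {x y} → x ≈ y → nonzero-or-1 x ≈ nonzero-or-1 y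
    nonzero-or-1-cong {x} {y} x≈y with x ≟ 0# | y ≟ 0#
    ... | yes _   | yes _   = refl
    ... | yes x≈0 | no  y≉0 = ⊥-elim (y≉0 (trans (sym x≈y) x≈0))
    ... | no  x≉0 | yes y≈0 = ⊥-elim (x≉0 (trans x≈y y≈0))
    ... | no  _   | no  _   = x≈y

    nonzero-or-1-≉0 : ∀ y → ¬ (nonzero-or-1 y ≈ 0#)
    nonzero-or-1-≉0 y with y ≟ 0#
    ... | yes _   = 1≉0
    ... | no  y≉0 = y≉0

    scale-unless-0 : Carrier → Carrier → Carrier
    scale-unless-0 x y with y ≟ 0#
    ... | yes _ = 1#
    ... | no  _ = x

    nonzero-or-1-* : ∀ x y → ¬ (x ≈ 0#) → nonzero-or-1 (x * y) ≈ scale-unless-0 x y * nonzero-or-1 y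
    nonzero-or-1-* x y x≉0 with y ≟ 0# | (x * y) ≟ 0#
    ... | yes _   | yes _    = sym (*-identityˡ _)
    ... | yes y≈0 | no  xy≉0 = ⊥-elim (xy≉0 (trans (*-congˡ y≈0) (zeroʳ x)))
    ... | no  y≉0 | yes xy≈0 = ⊥-elim (y≉0 (x*y≈0⇒y≈0 x y x≉0 xy≈0))
    ... | no  _   | no  _    = refl

    product-≉0 : ∀ k (f : Fin k → Carrier) → (∀ i → ¬ (f i ≈ 0#)) → ¬ (*-Sum.sum f ≈ 0#)
    product-≉0 zero    f f≉0 = 1≉0
    product-≉0 (suc k) f f≉0 = *-≉0 _ _ (f≉0 Fin.zero) (product-≉0 k (f ∘ Fin.suc) (f≉0 ∘ Fin.suc))

    product-const : ∀ k x → *-Sum.sum {k} (λ _ → x) ≈ pow F x k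
    product-const zero    x = refl
    product-const (suc k) x = *-congˡ (product-const k x)

    product-all-but-one : ∀ x k (f : Fin k → Carrier) (z : Fin k) → f z ≈ 1# → (∀ j → j ≢ z → f j ≈ x) →
      x * *-Sum.sum f ≈ pow F x k
    product-all-but-one x (suc k) f z fz≈1 fj≈x = begin
      x * *-Sum.sum f                                    ≈⟨ *-congˡ (*-Sum.sum-remove {i = z} f) ⟩
      x * (f z * *-Sum.sum (f ∘ Fin.punchIn z))          ≈⟨ *-congˡ (*-cong fz≈1 (*-Sum.sum-cong-≋ (λ j → fj≈x _ (FinP.punchInᵢ≢i z j)))) ⟩
      x * (1# * *-Sum.sum {k} (λ _ → x))                 ≈⟨ *-congˡ (trans (*-identityˡ _) (product-const k x)) ⟩
      pow F x (suc k)                                    ∎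

  -- Multiplication by x permutes F; comparing the products of all elements, with 0 replaced by 1, before
  -- and after the permutation shows x^(N-1) = 1.
  fermat-≉0 : ∀ x → ¬ (x ≈ 0#) → pow F x N ≈ x
  fermat-≉0 x x≉0 = begin
    pow F x N         ≈⟨ product-all-but-one x N (scale-unless-0 x ∘ enum) z (scale-at-0 z (proj₂ (enum-surj 0#)))
                            (λ j j≢z → scale-elsewhere j j≢z) ⟨
    x * Scales        ≈⟨ *-congˡ Scales≈1 ⟩
    x * 1#            ≈⟨ *-identityʳ x ⟩
    x                 ∎
    where
    z = proj₁ (enum-surj 0#)
    scale-at-0 : ∀ i → enum i ≈ 0# → scale-unless-0 x (enum i) ≈ 1#
    scale-at-0 i eᵢ≈0 with enum i ≟ 0#
    ... | yes _    = refl
    ... | no  eᵢ≉0 = ⊥-elim (eᵢ≉0 eᵢ≈0)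
    scale-elsewhere : ∀ j → j ≢ z → scale-unless-0 x (enum j) ≈ x
    scale-elsewhere j j≢z with enum j ≟ 0#
    ... | yes eⱼ≈0 = ⊥-elim (j≢z (enum-inj _ _ (trans eⱼ≈0 (sym (proj₂ (enum-surj 0#))))))
    ... | no  _    = refl
    Scales = *-Sum.sum (scale-unless-0 x ∘ enum)
    P = *-Sum.sum (nonzero-or-1 ∘ enum)
    P≈Scales*P : P ≈ Scales * P
    P≈Scales*P = begin
      P                                                ≈⟨ ∑-enum-bijection *-commutativeMonoid nonzero-or-1 nonzero-or-1-cong
                                                           (x *_) ((x ⁻¹) *_) *-congˡ *-congˡ
                                                           (cancel (⁻¹-inverse x x≉0)) (cancel (⁻¹-inverseˡ x x≉0)) ⟩
      *-Sum.sum (nonzero-or-1 ∘ (x *_) ∘ enum)         ≈⟨ *-Sum.sum-cong-≋ (λ i → nonzero-or-1-* x (enum i) x≉0) ⟩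
      *-Sum.sum (λ i → scale-unless-0 x (enum i) * nonzero-or-1 (enum i))
                                                       ≈⟨ *-Sum.∑-distrib-+ (scale-unless-0 x ∘ enum) (nonzero-or-1 ∘ enum) ⟩
      Scales * P                                       ∎
      where
      cancel : ∀ {a b} → a * b ≈ 1# → ∀ y → a * (b * y) ≈ y
      cancel ab≈1 y = trans (sym (*-assoc _ _ _)) (trans (*-congʳ ab≈1) (*-identityˡ y))
    Scales≈1 : Scales ≈ 1#
    Scales≈1 = sym (*-cancelˡ P (product-≉0 N _ (nonzero-or-1-≉0 ∘ enum))
                     (trans (*-identityʳ P) (trans P≈Scales*P (*-comm _ _))))

  fermat : ∀ x → pow F x N ≈ x
  fermat x with x ≟ 0# | enum-surj 0#
  ... | no  x≉0 | _ = fermat-≉0 x x≉0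
  ... | yes x≈0 | i , _ = trans (x≈0⇒pow≈0 x N x≈0 (NP.≤-<-trans ℕ.z≤n (FinP.toℕ<n i))) (sym x≈0)

module Characteristic {a ℓ : Level} (p m n : ℕ) (p-prime : Prime p) (F : FiniteField a ℓ ((p ^ m) ^ n)) where

  open import Data.Nat as ℕ using (zero; suc; _<_)
  import Data.Nat.Properties as NP
  open import Data.Nat.DivMod using (_%_; _/_; m≡m%n+[m/n]*n; m%n<n)
  open import Data.Nat.Divisibility using (divides; m%n≡0⇒n∣m)
  open import Data.Nat.Coprimality using (Coprime; prime⇒coprime; coprime-Bézout)
  open import Data.Nat.GCD using (module Bézout)
  open import Data.Nat.Combinatorics using (_C_; nCn≡1; nCk≡nC[n∸k])
  import Data.Nat.Primality as Primality
  open import Data.Fin as Fin using (Fin; toℕ; fromℕ; inject₁)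
  import Data.Fin.Properties as FinP
  open import Data.Empty using (⊥-elim)
  open import Relation.Nullary using (yes; no)
  import Relation.Binary.PropositionalEquality as ≡
  import Algebra.Properties.CommutativeSemiring.Binomial as Binomial
  import Algebra.Properties.Semiring.Mult as Mult
  import Algebra.Properties.Semiring.Sum as SemiringSum
  open FieldProperties F
  open FiniteFieldCounting F using (natF[N]≈0)
  open NatProperties using (prime>1; prime∣pCk)

  natF[p]≈0 : natF F p ≈ 0#
  natF[p]≈0 = pow≈0⇒≈0 _ m (pow≈0⇒≈0 _ n (begin
    pow F (pow F (natF F p) m) n ≈⟨ pow-congˡ n (natF-homo-^ p m) ⟨
    pow F (natF F (p ^ m)) n     ≈⟨ natF-homo-^ (p ^ m) n ⟨
    natF F ((p ^ m) ^ n)         ≈⟨ natF[N]≈0 ⟩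
    0#                           ∎))

  private
    instance
      p≢0 : ℕ.NonZero p
      p≢0 = Primality.prime⇒nonZero p-prime

    natF-*≈0 : ∀ x y → natF F y ≈ 0# → natF F (x ℕ.* y) ≈ 0#
    natF-*≈0 x y natF[y]≈0 = trans (natF-homo-* x y) (trans (*-congˡ natF[y]≈0) (zeroʳ _))

    1+u≡v⇒1≈0 : ∀ {u v} → 1 ℕ.+ u ≡ v → natF F u ≈ 0# → natF F v ≈ 0# → 1# ≈ 0#
    1+u≡v⇒1≈0 {u} {v} 1+u≡v u≈0 v≈0 = begin
      1#                    ≈⟨ +-identityʳ 1# ⟨
      1# + 0#               ≈⟨ +-congˡ u≈0 ⟨
      1# + natF F u         ≡⟨⟩
      natF F (1 ℕ.+ u)      ≡⟨ ≡.cong (natF F) 1+u≡v ⟩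
      natF F v              ≈⟨ v≈0 ⟩
      0#                    ∎

    coprime⇒natF≉0 : ∀ j → Coprime p j → ¬ (natF F j ≈ 0#)
    coprime⇒natF≉0 j cop natF[j]≈0 with coprime-Bézout cop
    ... | Bézout.+- x y 1+y*j≡x*p = 1≉0 (1+u≡v⇒1≈0 1+y*j≡x*p (natF-*≈0 y j natF[j]≈0) (natF-*≈0 x p natF[p]≈0))
    ... | Bézout.-+ x y 1+x*p≡y*j = 1≉0 (1+u≡v⇒1≈0 1+x*p≡y*j (natF-*≈0 x p natF[p]≈0) (natF-*≈0 y j natF[j]≈0))

  p∣k⇒natF[k]≈0 : ∀ k → p ∣ k → natF F k ≈ 0#
  p∣k⇒natF[k]≈0 k (divides j ≡.refl) = natF-*≈0 j p natF[p]≈0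

  natF[k]≈0⇒p∣k : ∀ k → natF F k ≈ 0# → p ∣ k
  natF[k]≈0⇒p∣k k natF[k]≈0 with k % p ℕ.≟ 0
  ... | yes k%p≡0 = m%n≡0⇒n∣m k p k%p≡0
  ... | no  k%p≢0 = ⊥-elim (coprime⇒natF≉0 j (prime⇒coprime p-prime {{ℕ.≢-nonZero k%p≢0}} (m%n<n k p)) natF[j]≈0)
    where
    j = k % p
    natF[j]≈0 : natF F j ≈ 0#
    natF[j]≈0 = begin
      natF F j                                ≈⟨ +-identityʳ _ ⟨
      natF F j + 0#                           ≈⟨ +-congˡ (natF-*≈0 (k / p) p natF[p]≈0) ⟨
      natF F j + natF F (k / p ℕ.* p)         ≈⟨ natF-homo-+ j _ ⟨
      natF F (j ℕ.+ k / p ℕ.* p)              ≡⟨ ≡.cong (natF F) (m≡m%n+[m/n]*n k p) ⟨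
      natF F k                                ≈⟨ natF[k]≈0 ⟩
      0#                                      ∎

  private
    module Bin = Binomial commutativeSemiring
    module Σ = SemiringSum semiring
    open Mult semiring using () renaming (_×_ to _×ₙ_)

    ×≈natF* : ∀ k x → k ×ₙ x ≈ natF F k * x
    ×≈natF* zero    x = sym (zeroˡ x)
    ×≈natF* (suc k) x = trans (+-cong (sym (*-identityˡ x)) (×≈natF* k x)) (sym (distribʳ _ _ _))

    natF≈1 : ∀ {k} → k ≡ 1 → natF F k ≈ 1#
    natF≈1 ≡.refl = +-identityʳ 1#

    sum-last : ∀ k (f : Fin (suc k) → Carrier) → (∀ (i : Fin k) → f (inject₁ i) ≈ 0#) → Σ.sum f ≈ f (fromℕ k)
    sum-last zero    f f≈0 = +-identityʳ _
    sum-last (suc k) f f≈0 = trans (+-cong (f≈0 Fin.zero) (sum-last k (f ∘′ Fin.suc) (λ i → f≈0 (Fin.suc i)))) (+-identityˡ _)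
      where open import Function.Base using (_∘′_)

  freshman’s-dream : ∀ k → (∀ j → 0 < j → j < suc k → natF F (suc k C j) ≈ 0#) →
    ∀ x y → pow F (x + y) (suc k) ≈ pow F x (suc k) + pow F y (suc k)
  freshman’s-dream k C≈0 x y = begin
    pow F (x + y) (suc k)                        ≈⟨ trans (reflexive (pow≡^ (x + y) (suc k))) (Bin.theorem (suc k) x y) ⟩
    term Fin.zero + Σ.sum (term ∘′ Fin.suc)      ≈⟨ +-congˡ (sum-last k (term ∘′ Fin.suc) inner≈0) ⟩
    term Fin.zero + term (Fin.suc (fromℕ k))     ≈⟨ +-cong first last ⟩
    pow F y (suc k) + pow F x (suc k)            ≈⟨ +-comm _ _ ⟩
    pow F x (suc k) + pow F y (suc k)            ∎
    where
    open import Function.Base using (_∘′_)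
    term = Bin.binomialTerm x y (suc k)
    term≈ : ∀ j → term j ≈ natF F (suc k C toℕ j) * (pow F x (toℕ j) * pow F y (suc k ℕ.∸ toℕ j))
    term≈ j rewrite pow≡^ x (toℕ j) | pow≡^ y (suc k ℕ.∸ toℕ j) = ×≈natF* (suc k C toℕ j) _
    first : term Fin.zero ≈ pow F y (suc k)
    first = trans (term≈ Fin.zero) (trans (*-congʳ (natF≈1 (≡.trans (nCk≡nC[n∸k] {0} {suc k} ℕ.z≤n) (nCn≡1 (suc k)))))
                                          (trans (*-identityˡ _) (*-identityˡ _)))
    last : term (Fin.suc (fromℕ k)) ≈ pow F x (suc k)
    last = trans (term≈ (Fin.suc (fromℕ k))) (top (toℕ (fromℕ k)) (FinP.toℕ-fromℕ k))
      where
      top : ∀ t → t ≡ k → natF F (suc k C suc t) * (pow F x (suc t) * pow F y (suc k ℕ.∸ suc t)) ≈ pow F x (suc k)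
      top t ≡.refl = trans (*-congʳ (natF≈1 (nCn≡1 (suc t))))
        (trans (*-identityˡ _) (trans (*-congˡ (reflexive (≡.cong (pow F y) (NP.n∸n≡0 t)))) (*-identityʳ _)))
    inner≈0 : ∀ (i : Fin k) → term (Fin.suc (inject₁ i)) ≈ 0#
    inner≈0 i = trans (term≈ (Fin.suc (inject₁ i)))
      (trans (*-congʳ (C≈0 _ (ℕ.s≤s ℕ.z≤n) (ℕ.s≤s (≡.subst (_< k) (≡.sym (FinP.toℕ-inject₁ i)) (FinP.toℕ<n i))))) (zeroˡ _))

  pow-p-homo-+ : ∀ x y → pow F (x + y) p ≈ pow F x p + pow F y p
  pow-p-homo-+ = dream p ≡.refl
    where
    dream : ∀ p′ → p′ ≡ p → ∀ x y → pow F (x + y) p′ ≈ pow F x p′ + pow F y p′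
    dream zero    0≡p  = ⊥-elim (NP.n≮0 (≡.subst (1 ℕ.<_) (≡.sym 0≡p) (prime>1 p-prime)))
    dream (suc k) 1+k≡p = freshman’s-dream k (λ j 0<j j<1+k →
      p∣k⇒natF[k]≈0 _ (≡.subst (_∣ (suc k C j)) 1+k≡p
        (prime∣pCk (≡.subst Prime (≡.sym 1+k≡p) p-prime) j 0<j j<1+k)))

module Frobenius {a ℓ : Level} (p m n : ℕ) (p-prime : Prime p) (F : FiniteField a ℓ ((p ^ m) ^ n)) where

  open import Data.Nat as ℕ using (zero; suc; _<_)
  open import Data.Nat.DivMod using (_%_; _/_)
  open NatProperties using (*-divmod)
  import Data.Nat.Properties as NP
  import Data.Nat.Primality as Primality
  import Relation.Binary.PropositionalEquality as ≡
  open FieldProperties F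
  open SumProperties F using (additive-sumF)
  open FiniteFieldCounting F using (fermat)
  open Characteristic p m n p-prime F using (pow-p-homo-+)

  q = p ^ m

  q^k>0 : ∀ k → 0 < q ^ k
  q^k>0 k = NP.m^n>0 q {{ℕ.>-nonZero (NP.m^n>0 p {{Primality.prime⇒nonZero p-prime}} m)}} k

  pow-p^j-homo-+ : ∀ j x y → pow F (x + y) (p ^ j) ≈ pow F x (p ^ j) + pow F y (p ^ j)
  pow-p^j-homo-+ zero    x y = trans (*-identityʳ _) (sym (+-cong (*-identityʳ x) (*-identityʳ y)))
  pow-p^j-homo-+ (suc j) x y = begin
    pow F (x + y) (p ℕ.* p ^ j)                       ≈⟨ pow-assocʳ (x + y) p (p ^ j) ⟨
    pow F (pow F (x + y) p) (p ^ j)                   ≈⟨ pow-congˡ (p ^ j) (pow-p-homo-+ x y) ⟩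
    pow F (pow F x p + pow F y p) (p ^ j)             ≈⟨ pow-p^j-homo-+ j _ _ ⟩
    pow F (pow F x p) (p ^ j) + pow F (pow F y p) (p ^ j) ≈⟨ +-cong (pow-assocʳ x p (p ^ j)) (pow-assocʳ y p (p ^ j)) ⟩
    pow F x (p ℕ.* p ^ j) + pow F y (p ℕ.* p ^ j)     ∎

  Fr : ℕ → Carrier → Carrier
  Fr k x = pow F x (q ^ k)

  Fr-cong : ∀ k {x y} → x ≈ y → Fr k x ≈ Fr k y
  Fr-cong k = pow-congˡ (q ^ k)

  Fr-homo-+ : ∀ k x y → Fr k (x + y) ≈ Fr k x + Fr k y
  Fr-homo-+ k x y rewrite NP.^-*-assoc p m k = pow-p^j-homo-+ (m ℕ.* k) x y

  Fr-0# : ∀ k → Fr k 0# ≈ 0#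
  Fr-0# k = x≈0⇒pow≈0 0# (q ^ k) refl (q^k>0 k)

  Fr-homo-‿ : ∀ k x → Fr k (- x) ≈ - Fr k x
  Fr-homo-‿ k x = +-inverseʳ-unique (Fr k x) (Fr k (- x))
    (trans (sym (Fr-homo-+ k x (- x))) (trans (Fr-cong k (-‿inverseʳ x)) (Fr-0# k)))

  Fr-homo-− : ∀ k x y → Fr k (x - y) ≈ Fr k x - Fr k y
  Fr-homo-− k x y = trans (Fr-homo-+ k x (- y)) (+-congˡ (Fr-homo-‿ k y))

  Fr-homo-* : ∀ k x y → Fr k (x * y) ≈ Fr k x * Fr k y
  Fr-homo-* k x y = pow-distrib-* x y (q ^ k)

  Fr-1# : ∀ k → Fr k 1# ≈ 1#
  Fr-1# k = pow-1# (q ^ k)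

  Fr-zero : ∀ x → Fr 0 x ≈ x
  Fr-zero = *-identityʳ

  Fr-∘ : ∀ j k x → Fr j (Fr k x) ≈ Fr (k ℕ.+ j) x
  Fr-∘ j k x = trans (pow-assocʳ x (q ^ k) (q ^ j)) (reflexive (≡.cong (pow F x) (≡.sym (NP.^-distribˡ-+-* q k j))))

  Fr-pow : ∀ k x e → Fr k (pow F x e) ≈ pow F (Fr k x) e
  Fr-pow k x e = pow-comm x e (q ^ k)

  Fr-natF : ∀ k j → Fr k (natF F j) ≈ natF F j
  Fr-natF k zero    = Fr-0# k
  Fr-natF k (suc j) = trans (Fr-homo-+ k 1# (natF F j)) (+-cong (Fr-1# k) (Fr-natF k j))

  Fr-⁻¹ : ∀ k x → ¬ (x ≈ 0#) → Fr k (x ⁻¹) ≈ (Fr k x) ⁻¹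
  Fr-⁻¹ k x x≉0 = ⁻¹-unique (Fr k x) (Fr k (x ⁻¹))
    (trans (sym (Fr-homo-* k x (x ⁻¹))) (trans (Fr-cong k (⁻¹-inverse x x≉0)) (Fr-1# k)))

  Fr-fixed-⁻¹ : ∀ k x → ¬ (x ≈ 0#) → Fr k x ≈ x → Fr k (x ⁻¹) ≈ x ⁻¹
  Fr-fixed-⁻¹ k x x≉0 x-fixed = trans (Fr-⁻¹ k x x≉0) (⁻¹-cong (λ Frx≈0 → x≉0 (trans (sym x-fixed) Frx≈0)) x-fixed)

  Fr-sumF : ∀ k t f → Fr k (sumF F t f) ≈ sumF F t (λ i → Fr k (f i))
  Fr-sumF k = additive-sumF (Fr k) (Fr-0# k) (Fr-homo-+ k)

  Fr-n : ∀ x → Fr n x ≈ x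
  Fr-n = fermat

  Fr-periodic : ∀ P x → Fr P x ≈ x → ∀ k b → Fr (k ℕ.* P ℕ.+ b) x ≈ Fr b x
  Fr-periodic P x x-fixed zero    b = refl
  Fr-periodic P x x-fixed (suc k) b = begin
    Fr (P ℕ.+ k ℕ.* P ℕ.+ b) x    ≡⟨ ≡.cong (λ e → Fr e x) (NP.+-assoc P (k ℕ.* P) b) ⟩
    Fr (P ℕ.+ (k ℕ.* P ℕ.+ b)) x  ≈⟨ Fr-∘ (k ℕ.* P ℕ.+ b) P x ⟨
    Fr (k ℕ.* P ℕ.+ b) (Fr P x)   ≈⟨ Fr-cong (k ℕ.* P ℕ.+ b) x-fixed ⟩
    Fr (k ℕ.* P ℕ.+ b) x          ≈⟨ Fr-periodic P x x-fixed k b ⟩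
    Fr b x                        ∎

  Fr-multiple : ∀ P x → Fr P x ≈ x → ∀ k → Fr (k ℕ.* P) x ≈ x
  Fr-multiple P x x-fixed k =
    trans (reflexive (≡.cong (λ e → Fr e x) (≡.sym (NP.+-identityʳ (k ℕ.* P))))) (trans (Fr-periodic P x x-fixed k 0) (Fr-zero x))

  Fr-*-mod : ∀ k l x .{{_ : ℕ.NonZero k}} → Fr (k ℕ.* l) x ≈ x → ∀ j → Fr (j ℕ.* l) x ≈ Fr (j % k ℕ.* l) x
  Fr-*-mod k l x x-fixed j = trans (reflexive (≡.cong (λ e → Fr e x) (*-divmod j k l))) (Fr-periodic (k ℕ.* l) x x-fixed (j / k) _)

module LinearisedPolynomial {a ℓ : Level} (p m n : ℕ) (p-prime : Prime p) (F : FiniteField a ℓ ((p ^ m) ^ n)) where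

  open import Data.Nat as ℕ using (_<_)
  import Data.Nat.Properties as NP
  import Relation.Binary.PropositionalEquality as ≡
  open FieldProperties F
  open SumProperties F
  open Frobenius p m n p-prime F

  record Linearised : Set a where
    constructor linearised
    field
      terms : ℕ
      coeff : ℕ → Carrier
      expo  : ℕ → ℕ

  open Linearised public

  ⟦_⟧ : Linearised → Carrier → Carrier
  ⟦ P ⟧ z = sumF F (terms P) (λ j → coeff P j * Fr (expo P j) z)

  ⟦⟧-cong : ∀ P {x y} → x ≈ y → ⟦ P ⟧ x ≈ ⟦ P ⟧ y
  ⟦⟧-cong P x≈y = sumF-cong′ (terms P) (λ j → *-congˡ (Fr-cong (expo P j) x≈y))

  ⟦⟧-0# : ∀ P → ⟦ P ⟧ 0# ≈ 0#
  ⟦⟧-0# P = trans (sumF-cong′ (terms P) (λ j → trans (*-congˡ (Fr-0# (expo P j))) (zeroʳ _))) (sumF-0# (terms P))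

  CoefficientsFixedBy : Linearised → Linearised → Set ℓ
  CoefficientsFixedBy Q P = ∀ i j → i < terms P → j < terms Q → Fr (expo P i) (coeff Q j) ≈ coeff Q j

  ⟦⟧-∘ : ∀ P Q z → CoefficientsFixedBy Q P →
    ⟦ P ⟧ (⟦ Q ⟧ z) ≈ sumF F (terms P) (λ i → sumF F (terms Q) (λ j →
                        coeff P i * coeff Q j * Fr (expo Q j ℕ.+ expo P i) z))
  ⟦⟧-∘ P Q z Q-fixed = sumF-cong (terms P) (λ i i< → begin
    coeff P i * Fr (expo P i) (⟦ Q ⟧ z)
      ≈⟨ *-congˡ (Fr-sumF (expo P i) (terms Q) _) ⟩
    coeff P i * sumF F (terms Q) (λ j → Fr (expo P i) (coeff Q j * Fr (expo Q j) z))
      ≈⟨ *-distribˡ-sumF (terms Q) (coeff P i) _ ⟩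
    sumF F (terms Q) (λ j → coeff P i * Fr (expo P i) (coeff Q j * Fr (expo Q j) z))
      ≈⟨ sumF-cong (terms Q) (λ j j< → begin
           coeff P i * Fr (expo P i) (coeff Q j * Fr (expo Q j) z)
             ≈⟨ *-congˡ (Fr-homo-* (expo P i) (coeff Q j) (Fr (expo Q j) z)) ⟩
           coeff P i * (Fr (expo P i) (coeff Q j) * Fr (expo P i) (Fr (expo Q j) z))
             ≈⟨ *-congˡ (*-cong (Q-fixed i j i< j<) (Fr-∘ (expo P i) (expo Q j) z)) ⟩
           coeff P i * (coeff Q j * Fr (expo Q j ℕ.+ expo P i) z)
             ≈⟨ *-assoc _ _ _ ⟨
           coeff P i * coeff Q j * Fr (expo Q j ℕ.+ expo P i) z ∎) ⟩
    sumF F (terms Q) (λ j → coeff P i * coeff Q j * Fr (expo Q j ℕ.+ expo P i) z) ∎)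

  ⟦⟧-comm : ∀ P Q z → CoefficientsFixedBy Q P → CoefficientsFixedBy P Q → ⟦ P ⟧ (⟦ Q ⟧ z) ≈ ⟦ Q ⟧ (⟦ P ⟧ z)
  ⟦⟧-comm P Q z Q-fixed P-fixed = begin
    ⟦ P ⟧ (⟦ Q ⟧ z)
      ≈⟨ ⟦⟧-∘ P Q z Q-fixed ⟩
    sumF F (terms P) (λ i → sumF F (terms Q) (λ j → coeff P i * coeff Q j * Fr (expo Q j ℕ.+ expo P i) z))
      ≈⟨ sumF-comm (terms P) (terms Q) _ ⟩
    sumF F (terms Q) (λ j → sumF F (terms P) (λ i → coeff P i * coeff Q j * Fr (expo Q j ℕ.+ expo P i) z))
      ≈⟨ sumF-cong′ (terms Q) (λ j → sumF-cong′ (terms P) (λ i →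
           *-cong (*-comm _ _) (reflexive (≡.cong (λ k → Fr k z) (NP.+-comm (expo Q j) (expo P i)))))) ⟩
    sumF F (terms Q) (λ j → sumF F (terms P) (λ i → coeff Q j * coeff P i * Fr (expo P i ℕ.+ expo Q j) z))
      ≈⟨ ⟦⟧-∘ Q P z P-fixed ⟨
    ⟦ Q ⟧ (⟦ P ⟧ z) ∎

  ⟦⟧-preserves-kernel : ∀ P Q z → CoefficientsFixedBy Q P → CoefficientsFixedBy P Q →
    ⟦ P ⟧ z ≈ 0# → ⟦ P ⟧ (⟦ Q ⟧ z) ≈ 0#
  ⟦⟧-preserves-kernel P Q z Q-fixed P-fixed Pz≈0 =
    trans (⟦⟧-comm P Q z Q-fixed P-fixed) (trans (⟦⟧-cong Q Pz≈0) (⟦⟧-0# Q))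

module PolynomialRoots {a ℓ : Level} {N : ℕ} (F : FiniteField a ℓ N) where

  open import Data.Nat as ℕ using (zero; suc; _<_)
  import Data.Nat.Properties as NP
  open import Data.Fin using (toℕ; fromℕ<)
  import Data.Fin.Properties as FinP
  open import Data.List using (List; []; _∷_; length; tabulate)
  open import Data.List.Properties using (length-tabulate)
  open import Data.List.Relation.Unary.All using (All; []; _∷_)
  import Data.List.Relation.Unary.All.Properties as All
  open import Data.List.Relation.Unary.AllPairs using (AllPairs; []; _∷_)
  import Data.List.Relation.Unary.AllPairs.Properties as AllPairs
  import Relation.Binary.PropositionalEquality as ≡
  open import Function.Base using (_∘_)
  open FieldProperties F
  open SumProperties F using (sumF-cons; sumF-cong′; *-distribˡ-sumF)

  eval : List Carrier → Carrier → Carrier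
  eval []       x = 0#
  eval (c ∷ cs) x = c + x * eval cs x

  deflate : Carrier → List Carrier → List Carrier
  deflate α []           = []
  deflate α (c ∷ [])     = []
  deflate α (c ∷ d ∷ cs) = eval (d ∷ cs) α ∷ deflate α (d ∷ cs)

  length-deflate : ∀ α c cs → length (deflate α (c ∷ cs)) ≡ length cs
  length-deflate α c []       = ≡.refl
  length-deflate α c (d ∷ cs) = ≡.cong suc (length-deflate α d cs)

  eval-deflate : ∀ P x α → eval P x ≈ eval P α + (x - α) * eval (deflate α P) x
  eval-deflate []            x α = sym (trans (+-identityˡ _) (zeroʳ _))
  eval-deflate (c ∷ [])      x α = begin
    c + x * 0#                       ≈⟨ +-congˡ (zeroʳ x) ⟩
    c + 0#                           ≈⟨ +-congˡ (zeroʳ α) ⟨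
    c + α * 0#                       ≈⟨ +-identityʳ _ ⟨
    (c + α * 0#) + 0#                ≈⟨ +-congˡ (zeroʳ (x - α)) ⟨
    (c + α * 0#) + (x - α) * 0#      ∎
  eval-deflate (c ∷ R@(_ ∷ _)) x α = begin
    c + x * eval R x                                             ≈⟨ +-congˡ (*-congˡ (eval-deflate R x α)) ⟩
    c + x * (eval R α + (x - α) * eval (deflate α R) x)          ≈⟨ solve 5 (λ c x α r d →
                                                                      c :+ x :* (r :+ (x :- α) :* d) := (c :+ α :* r) :+ (x :- α) :* (r :+ x :* d))
                                                                      refl c x α (eval R α) (eval (deflate α R) x) ⟩
    (c + α * eval R α) + (x - α) * (eval R α + x * eval (deflate α R) x) ∎

  deflate-≈0⇒≈0 : ∀ P α → All (_≈ 0#) (deflate α P) → eval P α ≈ 0# → All (_≈ 0#) P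
  deflate-≈0⇒≈0 []              α _          _     = []
  deflate-≈0⇒≈0 (c ∷ [])        α []         Pα≈0 = trans (sym (trans (+-congˡ (zeroʳ α)) (+-identityʳ c))) Pα≈0 ∷ []
  deflate-≈0⇒≈0 (c ∷ R@(_ ∷ _)) α (Rα≈0 ∷ D≈0) Pα≈0 =
    trans (sym (trans (+-congˡ (trans (*-congˡ Rα≈0) (zeroʳ α))) (+-identityʳ c))) Pα≈0 ∷ deflate-≈0⇒≈0 R α D≈0 Rα≈0

  private
    x-y≈0⇒x≈y : ∀ x y → x - y ≈ 0# → x ≈ y
    x-y≈0⇒x≈y x y x-y≈0 = trans (solve 2 (λ x y → x := (x :- y) :+ y) refl x y) (trans (+-congʳ x-y≈0) (+-identityˡ y))

  vanishing-on-distinct⇒≈0 : ∀ (pts : List Carrier) P → length P ℕ.≤ length pts →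
    AllPairs (λ x y → ¬ (x ≈ y)) pts → All (λ x → eval P x ≈ 0#) pts → All (_≈ 0#) P
  vanishing-on-distinct⇒≈0 []         []      _         _             _            = []
  vanishing-on-distinct⇒≈0 (α ∷ rest) []      _         _             _            = []
  vanishing-on-distinct⇒≈0 (α ∷ rest) (c ∷ R) (ℕ.s≤s ≤) (α≉ ∷ distinct) (Pα≈0 ∷ P≈0) =
    deflate-≈0⇒≈0 (c ∷ R) α
      (vanishing-on-distinct⇒≈0 rest (deflate α (c ∷ R)) (≡.subst (ℕ._≤ length rest) (≡.sym (length-deflate α c R)) ≤)
        distinct (deflated-vanishes rest α≉ P≈0))
      Pα≈0
    where
    deflated-vanishes : ∀ xs → All (λ y → ¬ (α ≈ y)) xs → All (λ x → eval (c ∷ R) x ≈ 0#) xs →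
      All (λ x → eval (deflate α (c ∷ R)) x ≈ 0#) xs
    deflated-vanishes []       []           []            = []
    deflated-vanishes (β ∷ xs) (α≉β ∷ α≉xs) (Pβ≈0 ∷ P≈0) =
      x*y≈0⇒y≈0 (β - α) _ (λ β-α≈0 → α≉β (sym (x-y≈0⇒x≈y β α β-α≈0))) (begin
        (β - α) * eval (deflate α (c ∷ R)) β                       ≈⟨ +-identityˡ _ ⟨
        0# + (β - α) * eval (deflate α (c ∷ R)) β                  ≈⟨ +-congʳ Pα≈0 ⟨
        eval (c ∷ R) α + (β - α) * eval (deflate α (c ∷ R)) β      ≈⟨ eval-deflate (c ∷ R) β α ⟨
        eval (c ∷ R) β                                             ≈⟨ Pβ≈0 ⟩
        0#                                                         ∎)
      ∷ deflated-vanishes xs α≉xs P≈0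

  eval-tabulate : ∀ k f x → eval (tabulate {n = k} (f ∘ toℕ)) x ≈ sumF F k (λ i → f i * pow F x i)
  eval-tabulate zero    f x = refl
  eval-tabulate (suc k) f x = begin
    f 0 + x * eval (tabulate {n = k} (f ∘ suc ∘ toℕ)) x           ≈⟨ +-congˡ (*-congˡ (eval-tabulate k (f ∘ suc) x)) ⟩
    f 0 + x * sumF F k (λ i → f (suc i) * pow F x i)              ≈⟨ +-congˡ (*-distribˡ-sumF k x _) ⟩
    f 0 + sumF F k (λ i → x * (f (suc i) * pow F x i))            ≈⟨ +-cong (*-identityʳ (f 0)) (sumF-cong′ k (λ i → x*[y*z]≈y*[x*z] (f (suc i)) x _)) ⟨
    f 0 * 1# + sumF F k (λ i → f (suc i) * pow F x (suc i))       ≈⟨ sumF-cons k (λ i → f i * pow F x i) ⟨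
    sumF F (suc k) (λ i → f i * pow F x i)                        ∎
    where
    x*[y*z]≈y*[x*z] : ∀ x y z → x * (y * z) ≈ y * (x * z)
    x*[y*z]≈y*[x*z] = solve 3 (λ x y z → x :* (y :* z) := y :* (x :* z)) refl

  vanishing-everywhere⇒≈0 : ∀ f → (∀ w → sumF F N (λ i → f i * pow F w i) ≈ 0#) → ∀ i → i < N → f i ≈ 0#
  vanishing-everywhere⇒≈0 f f≈0 i i<N =
    trans (reflexive (≡.cong f (≡.sym (FinP.toℕ-fromℕ< i<N))))
      (All.tabulate⁻ (vanishing-on-distinct⇒≈0 (tabulate enum) (tabulate {n = N} (f ∘ toℕ))
        (NP.≤-reflexive (≡.trans (length-tabulate _) (≡.sym (length-tabulate enum))))
        (AllPairs.tabulate⁺ (λ i≢j enumᵢ≈enumⱼ → i≢j (enum-inj _ _ enumᵢ≈enumⱼ)))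
        (All.tabulate⁺ (λ j → trans (eval-tabulate N f (enum j)) (f≈0 (enum j)))))
        (fromℕ< i<N))

module BinomialOnTraceKernel {a ℓ : Level} (p m n r s : ℕ) (p-prime : Prime p) (m≥1 : 1 ≤ m) (n≥1 : 1 ≤ n)
  (r≥1 : 1 ≤ r) (s≥1 : 1 ≤ s) (s∣n : s ∣ n) (gcd≡ : gcd n r ≡ gcd s r) (F : FiniteField a ℓ ((p ^ m) ^ n))
  (c : FiniteField.Carrier F) (c-fixed : FiniteField._≈_ F (pow F c ((p ^ m) ^ s)) c)
  (norm≈1 : FiniteField._≈_ F (norm F (p ^ m) s (gcd n r) c) (FiniteField.1# F)) where

  open import Data.Nat as ℕ using (zero; suc; _<_; _∸_)
  import Data.Nat.Properties as NP
  open import Data.Nat.DivMod using (_%_; _/_; m%n<n; m≡m%n+[m/n]*n; m<n⇒m%n≡m)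
  open import Data.Nat.Divisibility using (m%n≡0⇒n∣m)
  open import Data.Empty using (⊥-elim)
  import Relation.Binary.PropositionalEquality as ≡
  open ≡ using (_≢_)
  open import Function.Base using (_∘_)
  open NatProperties
  open Exponents n r s n≥1 r≥1 s≥1 s∣n gcd≡
  open FieldProperties F
  open SumProperties F
  open Frobenius p m n p-prime F
  open PolynomialRoots F using (vanishing-everywhere⇒≈0)

  q>1 : 1 < q
  q>1 = NP.^-monoʳ-< p (prime>1 p-prime) m≥1

  q^k>1 : ∀ k → 1 ≤ k → 1 < q ^ k
  q^k>1 k k≥1 = NP.^-monoʳ-< q q>1 k≥1

  B = q ^ r

  B^j≡q^[j*r] : ∀ j → B ^ j ≡ q ^ (j ℕ.* r)
  B^j≡q^[j*r] j = ≡.trans (NP.^-*-assoc q r j) (≡.cong (q ^_) (NP.*-comm r j))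

  E : ℕ → ℕ
  E j = (q ^ (suc j ℕ.* r) ∸ 1) div (q ^ r ∸ 1)

  E≡∑B^i : ∀ j → E j ≡ sumℕ (suc j) (B ^_)
  E≡∑B^i j = ≡.trans (≡.cong (λ k → (k ∸ 1) div (q ^ r ∸ 1)) (≡.sym (B^j≡q^[j*r] (suc j))))
                     (geometric-sum-div B (suc j) (q^k>1 r r≥1))

  E-suc : ∀ j → E (suc j) ≡ suc (B ℕ.* E j)
  E-suc j = ≡.trans (E≡∑B^i (suc j)) (≡.trans (sumℕ-cons (suc j) (B ^_))
    (≡.cong suc (≡.trans (≡.sym (*-distribˡ-sumℕ (suc j) B (B ^_))) (≡.cong (B ℕ.*_) (≡.sym (E≡∑B^i j))))))

  E-suc′ : ∀ j → E (suc j) ≡ E j ℕ.+ B ^ suc j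
  E-suc′ j = ≡.trans (E≡∑B^i (suc j)) (≡.cong (ℕ._+ B ^ suc j) (≡.sym (E≡∑B^i j)))

  c-fixed-by-s-multiples : ∀ k → Fr (k ℕ.* s) c ≈ c
  c-fixed-by-s-multiples = Fr-multiple s c c-fixed

  norm-exponent : (q ^ s ∸ 1) div (q ^ d ∸ 1) ≡ sumℕ e ((q ^ d) ^_)
  norm-exponent = ≡.trans
    (≡.cong (λ k → (k ∸ 1) div (q ^ d ∸ 1))
      (≡.trans (≡.cong (q ^_) (≡.trans s≡e*d (NP.*-comm e d))) (≡.sym (NP.^-*-assoc q d e))))
    (geometric-sum-div (q ^ d) e (q^k>1 d d>0))

  c^∑B^i≈1 : pow F c (sumℕ e (B ^_)) ≈ 1#
  c^∑B^i≈1 = begin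
    pow F c (sumℕ e (B ^_))                  ≈⟨ pow-sumℕ c e (B ^_) ⟩
    prodF e (pow F c ∘ (B ^_))               ≈⟨ *-BigOp.bigop-cong e (λ i _ → reflexive (≡.cong (pow F c) (B^j≡q^[j*r] i))) ⟩
    prodF e (λ i → Fr (i ℕ.* r) c)           ≈⟨ *-BigOp.bigop-cong e (λ i _ → Fr-i*r≈Fr-[i*r′%e]*d i) ⟩
    prodF e (λ i → Fr ((i ℕ.* r′) % e ℕ.* d) c) ≈⟨ *-BigOp.bigop-reindex e (λ k → Fr (k ℕ.* d) c) (λ i → (i ℕ.* r′) % e)
                                                  (λ i _ → m%n<n (i ℕ.* r′) e) (*-mod-injective coprime-e-r′) ⟩
    prodF e (λ i → Fr (i ℕ.* d) c)           ≈⟨ *-BigOp.bigop-cong e (λ i _ → reflexive (≡.cong (pow F c) (q^[i*d]≡[q^d]^i i))) ⟩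
    prodF e (pow F c ∘ ((q ^ d) ^_))         ≈⟨ pow-sumℕ c e ((q ^ d) ^_) ⟨
    pow F c (sumℕ e ((q ^ d) ^_))            ≡⟨ ≡.cong (pow F c) norm-exponent ⟨
    norm F q s d c                           ≈⟨ norm≈1 ⟩
    1#                                       ∎
    where
    q^[i*d]≡[q^d]^i : ∀ i → q ^ (i ℕ.* d) ≡ (q ^ d) ^ i
    q^[i*d]≡[q^d]^i i = ≡.trans (≡.cong (q ^_) (NP.*-comm i d)) (≡.sym (NP.^-*-assoc q d i))
    Fr-i*r≈Fr-[i*r′%e]*d : ∀ i → Fr (i ℕ.* r) c ≈ Fr ((i ℕ.* r′) % e ℕ.* d) c
    Fr-i*r≈Fr-[i*r′%e]*d i = begin
      Fr (i ℕ.* r) c               ≡⟨ ≡.cong (λ k → Fr k c) (≡.trans (≡.cong (i ℕ.*_) r≡r′*d) (≡.sym (NP.*-assoc i r′ d))) ⟩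
      Fr (i ℕ.* r′ ℕ.* d) c        ≈⟨ Fr-*-mod e d c (≡.subst (λ k → Fr k c ≈ c) s≡e*d c-fixed) (i ℕ.* r′) ⟩
      Fr ((i ℕ.* r′) % e ℕ.* d) c  ∎

  c≉0 : ¬ (c ≈ 0#)
  c≉0 c≈0 = 1≉0 (trans (sym c^∑B^i≈1) (c^∑≈0 e e>0))
    where
    c^∑≈0 : ∀ k → 0 < k → pow F c (sumℕ k (B ^_)) ≈ 0#
    c^∑≈0 (suc k) _ = trans (pow-homo-+ c (sumℕ k (B ^_)) (B ^ k))
      (trans (*-congˡ (x≈0⇒pow≈0 c (B ^ k) c≈0 (NP.m^n>0 B {{ℕ.>-nonZero (q^k>0 r)}} k))) (zeroʳ _))

  u = c ⁻¹

  uᵏ*cᵏ≈1 : ∀ k → pow F u k * pow F c k ≈ 1#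
  uᵏ*cᵏ≈1 k = trans (sym (pow-distrib-* u c k)) (trans (pow-congˡ k (⁻¹-inverseˡ c c≉0)) (pow-1# k))

  γ : ℕ → Carrier
  γ j = pow F u (E j)

  γ₀≈u : γ 0 ≈ u
  γ₀≈u = trans (reflexive (≡.cong (pow F u) (E≡∑B^i 0))) (*-identityʳ u)

  c*γ₀≈1 : c * γ 0 ≈ 1#
  c*γ₀≈1 = trans (*-congˡ γ₀≈u) (⁻¹-inverse c c≉0)

  c*γ[1+j]≈Fr-r-γ[j] : ∀ j → c * γ (suc j) ≈ Fr r (γ j)
  c*γ[1+j]≈Fr-r-γ[j] j = begin
    c * pow F u (E (suc j))            ≡⟨ ≡.cong (λ k → c * pow F u k) (E-suc j) ⟩
    c * (u * pow F u (B ℕ.* E j))      ≈⟨ *-assoc _ _ _ ⟨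
    (c * u) * pow F u (B ℕ.* E j)      ≈⟨ *-congʳ (⁻¹-inverse c c≉0) ⟩
    1# * pow F u (B ℕ.* E j)           ≈⟨ *-identityˡ _ ⟩
    pow F u (B ℕ.* E j)                ≡⟨ ≡.cong (pow F u) (NP.*-comm B (E j)) ⟩
    pow F u (E j ℕ.* B)                ≈⟨ pow-assocʳ u (E j) B ⟨
    Fr r (γ j)                         ∎

  γ[1+j]*Fr-[1+j]r-c≈γ[j] : ∀ j → γ (suc j) * Fr (suc j ℕ.* r) c ≈ γ j
  γ[1+j]*Fr-[1+j]r-c≈γ[j] j = begin
    pow F u (E (suc j)) * Fr (suc j ℕ.* r) c           ≡⟨ ≡.cong₂ (λ k l → pow F u k * pow F c l) (E-suc′ j) (≡.sym (B^j≡q^[j*r] (suc j))) ⟩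
    pow F u (E j ℕ.+ B ^ suc j) * pow F c (B ^ suc j)  ≈⟨ *-congʳ (pow-homo-+ u (E j) (B ^ suc j)) ⟩
    (γ j * pow F u (B ^ suc j)) * pow F c (B ^ suc j)  ≈⟨ *-assoc _ _ _ ⟩
    γ j * (pow F u (B ^ suc j) * pow F c (B ^ suc j))  ≈⟨ *-congˡ (uᵏ*cᵏ≈1 (B ^ suc j)) ⟩
    γ j * 1#                                           ≈⟨ *-identityʳ _ ⟩
    γ j                                                ∎

  γ[e-1]≈1 : ∀ k → suc k ≡ e → γ k ≈ 1#
  γ[e-1]≈1 k 1+k≡e = begin
    pow F u (E k)                                      ≡⟨ ≡.cong (pow F u) (≡.trans (E≡∑B^i k) (≡.cong (λ l → sumℕ l (B ^_)) 1+k≡e)) ⟩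
    pow F u (sumℕ e (B ^_))                            ≈⟨ *-identityʳ _ ⟨
    pow F u (sumℕ e (B ^_)) * 1#                       ≈⟨ *-congˡ c^∑B^i≈1 ⟨
    pow F u (sumℕ e (B ^_)) * pow F c (sumℕ e (B ^_))  ≈⟨ uᵏ*cᵏ≈1 (sumℕ e (B ^_)) ⟩
    1#                                                 ∎

  L : Carrier → Carrier
  L = Lbin F q r c

  L-cong : ∀ {x y} → x ≈ y → L x ≈ L y
  L-cong x≈y = +-cong (Fr-cong r x≈y) (-‿cong (*-congˡ x≈y))

  A : Carrier → Carrier
  A z = sumF F e (λ j → γ j * Fr (j ℕ.* r) z)

  A-cong : ∀ {x y} → x ≈ y → A x ≈ A y
  A-cong x≈y = sumF-cong′ e (λ j → *-congˡ (Fr-cong (j ℕ.* r) x≈y))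

  P = e ℕ.* r

  Φ : Carrier → Carrier
  Φ = Fr P

  private
    [a+b]-[z+a]≈b-z : ∀ a b z → (a + b) - (z + a) ≈ b - z
    [a+b]-[z+a]≈b-z = solve 3 (λ a b z → (a :+ b) :- (z :+ a) := b :- z) refl

    Fr-r∘Fr-jr : ∀ j z → Fr r (Fr (j ℕ.* r) z) ≈ Fr (suc j ℕ.* r) z
    Fr-r∘Fr-jr j z = trans (Fr-∘ r (j ℕ.* r) z) (reflexive (≡.cong (λ k → Fr k z) (NP.+-comm (j ℕ.* r) r)))

  L∘partial-A : ∀ k z → L (sumF F (suc k) (λ j → γ j * Fr (j ℕ.* r) z)) ≈ Fr r (γ k) * Fr (suc k ℕ.* r) z - z
  L∘partial-A k z = begin
    Fr r (Aₖ) - c * Aₖ              ≈⟨ +-cong Fr-r-Aₖ (-‿cong c*Aₖ) ⟩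
    (sumF F k W + W k) - (z + sumF F k W) ≈⟨ [a+b]-[z+a]≈b-z (sumF F k W) (W k) z ⟩
    W k - z                          ∎
    where
    Aₖ = sumF F (suc k) (λ j → γ j * Fr (j ℕ.* r) z)
    W : ℕ → Carrier
    W j = Fr r (γ j) * Fr (suc j ℕ.* r) z
    Fr-r-Aₖ : Fr r Aₖ ≈ sumF F (suc k) W
    Fr-r-Aₖ = trans (Fr-sumF r (suc k) _) (sumF-cong′ (suc k) (λ j → trans (Fr-homo-* r _ _) (*-congˡ (Fr-r∘Fr-jr j z))))
    c*Aₖ : c * Aₖ ≈ z + sumF F k W
    c*Aₖ = begin
      c * Aₖ                                                          ≈⟨ *-distribˡ-sumF (suc k) c _ ⟩
      sumF F (suc k) (λ j → c * (γ j * Fr (j ℕ.* r) z))               ≈⟨ sumF-cons k _ ⟩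
      c * (γ 0 * Fr 0 z) + sumF F k (λ j → c * (γ (suc j) * Fr (suc j ℕ.* r) z))
        ≈⟨ +-cong (trans (sym (*-assoc _ _ _)) (trans (*-cong c*γ₀≈1 (Fr-zero z)) (*-identityˡ z)))
                  (sumF-cong′ k (λ j → trans (sym (*-assoc _ _ _)) (*-congʳ (c*γ[1+j]≈Fr-r-γ[j] j)))) ⟩
      z + sumF F k W                                                  ∎

  partial-A∘L : ∀ k z → sumF F (suc k) (λ j → γ j * Fr (j ℕ.* r) (L z)) ≈ γ k * Fr (suc k ℕ.* r) z - z
  partial-A∘L k z = begin
    sumF F (suc k) (λ j → γ j * Fr (j ℕ.* r) (L z)) ≈⟨ sumF-cong′ (suc k) term ⟩
    sumF F (suc k) (λ j → V j - Y j)                ≈⟨ sumF-distrib-− (suc k) V Y ⟩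
    (sumF F k V + V k) - sumF F (suc k) Y           ≈⟨ +-congˡ (-‿cong ∑Y) ⟩
    (sumF F k V + V k) - (z + sumF F k V)           ≈⟨ [a+b]-[z+a]≈b-z (sumF F k V) (V k) z ⟩
    V k - z                                         ∎
    where
    V : ℕ → Carrier
    V j = γ j * Fr (suc j ℕ.* r) z
    Y : ℕ → Carrier
    Y j = (γ j * Fr (j ℕ.* r) c) * Fr (j ℕ.* r) z
    term : ∀ j → γ j * Fr (j ℕ.* r) (L z) ≈ V j - Y j
    term j = begin
      γ j * Fr (j ℕ.* r) (L z)
        ≈⟨ *-congˡ (trans (Fr-homo-− (j ℕ.* r) _ _) (+-cong (Fr-∘ (j ℕ.* r) r z) (-‿cong (Fr-homo-* (j ℕ.* r) c z)))) ⟩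
      γ j * (Fr (suc j ℕ.* r) z - Fr (j ℕ.* r) c * Fr (j ℕ.* r) z)
        ≈⟨ solve 4 (λ a b x y → a :* (b :- x :* y) := a :* b :- (a :* x) :* y) refl _ _ _ _ ⟩
      V j - Y j ∎
    ∑Y : sumF F (suc k) Y ≈ z + sumF F k V
    ∑Y = trans (sumF-cons k Y)
      (+-cong (trans (*-congʳ (trans (*-congˡ (Fr-zero c)) (trans (*-comm _ _) c*γ₀≈1))) (trans (*-identityˡ _) (Fr-zero z)))
              (sumF-cong′ k (λ j → *-congʳ (γ[1+j]*Fr-[1+j]r-c≈γ[j] j))))

  L∘A≈Φ-id : ∀ z → L (A z) ≈ Φ z - z
  L∘A≈Φ-id z = split e ≡.refl
    where
    split : ∀ e′ → e′ ≡ e → L (sumF F e′ (λ j → γ j * Fr (j ℕ.* r) z)) ≈ Fr (e′ ℕ.* r) z - z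
    split zero    0≡e   = ⊥-elim (NP.<⇒≢ e>0 0≡e)
    split (suc k) 1+k≡e = trans (L∘partial-A k z)
      (+-congʳ (trans (*-congʳ (trans (Fr-cong r (γ[e-1]≈1 k 1+k≡e)) (Fr-1# r))) (*-identityˡ _)))

  A∘L≈Φ-id : ∀ z → A (L z) ≈ Φ z - z
  A∘L≈Φ-id z = split e ≡.refl
    where
    split : ∀ e′ → e′ ≡ e → sumF F e′ (λ j → γ j * Fr (j ℕ.* r) (L z)) ≈ Fr (e′ ℕ.* r) z - z
    split zero    0≡e   = ⊥-elim (NP.<⇒≢ e>0 0≡e)
    split (suc k) 1+k≡e = trans (partial-A∘L k z) (+-congʳ (trans (*-congʳ (γ[e-1]≈1 k 1+k≡e)) (*-identityˡ _)))

  T : Carrier → Carrier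
  T = trace F q n s

  T-cong : ∀ {x y} → x ≈ y → T x ≈ T y
  T-cong x≈y = sumF-cong′ t (λ i → Fr-cong (i ℕ.* s) x≈y)

  Φᵗ≈id : ∀ y → Fr (t ℕ.* P) y ≈ y
  Φᵗ≈id y = trans (reflexive (≡.cong (λ k → Fr k y) t*[e*r]≡r′*n)) (Fr-multiple n y (Fr-n y) r′)

  ∑Φᵏ≈T : ∀ y → sumF F t (λ k → Fr (k ℕ.* P) y) ≈ T y
  ∑Φᵏ≈T y = begin
    sumF F t (λ k → Fr (k ℕ.* P) y)                 ≈⟨ sumF-cong′ t Φᵏ≈Fr-[kr′%t]s ⟩
    sumF F t (λ k → Fr ((k ℕ.* r′) % t ℕ.* s) y)    ≈⟨ sumF-reindex t (λ i → Fr (i ℕ.* s) y) (λ k → (k ℕ.* r′) % t)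
                                                         (λ i _ → m%n<n (i ℕ.* r′) t) (*-mod-injective coprime-t-r′) ⟩
    T y                                             ∎
    where
    Φᵏ≈Fr-[kr′%t]s : ∀ k → Fr (k ℕ.* P) y ≈ Fr ((k ℕ.* r′) % t ℕ.* s) y
    Φᵏ≈Fr-[kr′%t]s k = begin
      Fr (k ℕ.* (e ℕ.* r)) y       ≡⟨ ≡.cong (λ l → Fr l y) (≡.trans (≡.cong (k ℕ.*_) e*r≡r′*s) (≡.sym (NP.*-assoc k r′ s))) ⟩
      Fr (k ℕ.* r′ ℕ.* s) y        ≈⟨ Fr-*-mod t s y (≡.subst (λ l → Fr l y ≈ y) n≡t*s (Fr-n y)) (k ℕ.* r′) ⟩
      Fr ((k ℕ.* r′) % t ℕ.* s) y  ∎

  H : ℕ → Carrier → Carrier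
  H M y = sumF F M (λ i → natF F (suc i) * Fr (suc i ℕ.* P) y)

  Φ∘H-H : ∀ M y → Fr (suc M ℕ.* P) y ≈ y →
    Φ (H M y) - H M y ≈ natF F (suc M) * y - sumF F (suc M) (λ k → Fr (k ℕ.* P) y)
  Φ∘H-H M y Φ¹⁺ᴹy≈y = begin
    Φ (H M y) - H M y                                          ≈⟨ +-congʳ Φ∘H ⟩
    sumF F M (λ i → natF F (suc i) * Φᵏ (suc (suc i))) - H M y ≈⟨ sumF-by-parts M Φᵏ ⟩
    natF F M * Φᵏ (suc M) - sumF F M (Φᵏ ∘ suc)                ≈⟨ +-cong (*-congˡ Φ¹⁺ᴹy≈y) (-‿cong (sym ∑Φᵏ-y)) ⟩
    natF F M * y - (sumF F (suc M) Φᵏ - y)                     ≈⟨ solve 3 (λ n y S → n :* y :- (S :- y) := (y :+ n :* y) :- S) refl (natF F M) y _ ⟩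
    (y + natF F M * y) - sumF F (suc M) Φᵏ                     ≈⟨ +-congʳ (trans (+-congʳ (sym (*-identityˡ y))) (sym (distribʳ y 1# (natF F M)))) ⟩
    (1# + natF F M) * y - sumF F (suc M) Φᵏ                    ∎
    where
    Φᵏ : ℕ → Carrier
    Φᵏ k = Fr (k ℕ.* P) y
    Φ∘H : Φ (H M y) ≈ sumF F M (λ i → natF F (suc i) * Φᵏ (suc (suc i)))
    Φ∘H = trans (Fr-sumF P M _) (sumF-cong′ M (λ i → trans (Fr-homo-* P _ _) (*-cong (Fr-natF P (suc i))
      (trans (Fr-∘ P (suc i ℕ.* P) y) (reflexive (≡.cong (λ k → Fr k y) (NP.+-comm (suc i ℕ.* P) P)))))))
    ∑Φᵏ-y : sumF F (suc M) Φᵏ - y ≈ sumF F M (Φᵏ ∘ suc)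
    ∑Φᵏ-y = trans (+-congʳ (trans (sumF-cons M Φᵏ) (+-congʳ (Fr-zero y)))) (solve 2 (λ y S → (y :+ S) :- y := S) refl y _)

  Φ∘H-H≈t*y-T : ∀ y → Φ (H (t ∸ 1) y) - H (t ∸ 1) y ≈ natF F t * y - T y
  Φ∘H-H≈t*y-T y = trans (split t ≡.refl) (+-congˡ (-‿cong (∑Φᵏ≈T y)))
    where
    split : ∀ t′ → t′ ≡ t → Φ (H (t′ ∸ 1) y) - H (t′ ∸ 1) y ≈ natF F t′ * y - sumF F t′ (λ k → Fr (k ℕ.* P) y)
    split zero    0≡t   = ⊥-elim (NP.<⇒≢ t>0 0≡t)
    split (suc M) 1+M≡t = Φ∘H-H M y (≡.subst (λ l → Fr (l ℕ.* P) y ≈ y) (≡.sym 1+M≡t) (Φᵗ≈id y))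

  H′ : Carrier → Carrier
  H′ y = sumF F (t ∸ 1) (λ i → natF F (suc i) * pow F y (q ^ ((suc i ℕ.* s ℕ.* r) div d)))

  H′≈H : ∀ y → H′ y ≈ H (t ∸ 1) y
  H′≈H y = sumF-cong′ (t ∸ 1) (λ i → reflexive (≡.cong (λ k → natF F (suc i) * Fr k y) ([k*s*r]div-d≡k*[e*r] (suc i))))

  t⁻¹ = natF F t ⁻¹

  G : Carrier → Carrier
  G y = t⁻¹ * H′ y

  -- Definitionally equal to invPoly F q n r s d c.
  inverse : Carrier → Carrier
  inverse y = A (G y)

  inverse-cong : ∀ {x y} → x ≈ y → inverse x ≈ inverse y
  inverse-cong x≈y = A-cong (*-congˡ (sumF-cong′ (t ∸ 1) (λ i → *-congˡ (Fr-cong ((suc i ℕ.* s ℕ.* r) div d) x≈y))))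

  module _ (t≉0 : ¬ (natF F t ≈ 0#)) where

    Φ∘G-G≈id : ∀ y → T y ≈ 0# → Φ (G y) - G y ≈ y
    Φ∘G-G≈id y Ty≈0 = begin
      Φ (G y) - G y                                  ≈⟨ +-congʳ (trans (Fr-homo-* P t⁻¹ (H′ y)) (*-congʳ (Fr-fixed-⁻¹ P _ t≉0 (Fr-natF P t)))) ⟩
      t⁻¹ * Φ (H′ y) - t⁻¹ * H′ y                    ≈⟨ solve 3 (λ a b c → a :* b :- a :* c := a :* (b :- c)) refl t⁻¹ _ _ ⟩
      t⁻¹ * (Φ (H′ y) - H′ y)                        ≈⟨ *-congˡ (+-cong (Fr-cong P (H′≈H y)) (-‿cong (H′≈H y))) ⟩
      t⁻¹ * (Φ (H (t ∸ 1) y) - H (t ∸ 1) y)          ≈⟨ *-congˡ (Φ∘H-H≈t*y-T y) ⟩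
      t⁻¹ * (natF F t * y - T y)                     ≈⟨ *-congˡ (+-congˡ (trans (-‿cong Ty≈0) -0#≈0#)) ⟩
      t⁻¹ * (natF F t * y + 0#)                      ≈⟨ *-congˡ (+-identityʳ _) ⟩
      t⁻¹ * (natF F t * y)                           ≈⟨ *-assoc _ _ _ ⟨
      (t⁻¹ * natF F t) * y                           ≈⟨ *-congʳ (⁻¹-inverseˡ _ t≉0) ⟩
      1# * y                                         ≈⟨ *-identityˡ y ⟩
      y                                              ∎

  open LinearisedPolynomial p m n p-prime F

  Lᴾ : Linearised
  Lᴾ = linearised 2 coeffᴸ expoᴸ
    where
    coeffᴸ : ℕ → Carrier
    coeffᴸ zero    = - c
    coeffᴸ (suc _) = 1#
    expoᴸ : ℕ → ℕ
    expoᴸ zero    = 0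
    expoᴸ (suc _) = r

  ⟦Lᴾ⟧≈L : ∀ x → ⟦ Lᴾ ⟧ x ≈ L x
  ⟦Lᴾ⟧≈L x = begin
    (0# + - c * Fr 0 x) + 1# * Fr r x ≈⟨ +-cong (trans (+-identityˡ _) (*-congˡ (Fr-zero x))) (*-identityˡ _) ⟩
    - c * x + Fr r x                  ≈⟨ solve 3 (λ c x y → (:- c) :* x :+ y := y :- c :* x) refl c x (Fr r x) ⟩
    Fr r x - c * x                    ∎

  Tᴾ : Linearised
  Tᴾ = linearised t (λ _ → 1#) (λ i → i ℕ.* s)

  ⟦Tᴾ⟧≈T : ∀ y → ⟦ Tᴾ ⟧ y ≈ T y
  ⟦Tᴾ⟧≈T y = sumF-cong′ t (λ i → *-identityˡ _)

  Aᴾ : Linearised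
  Aᴾ = linearised e γ (λ j → j ℕ.* r)

  Tᴾ-coefficients-fixed : ∀ P → CoefficientsFixedBy Tᴾ P
  Tᴾ-coefficients-fixed P i j _ _ = Fr-1# (expo P i)

  Lᴾ-coefficients-fixed : ∀ k → Fr k c ≈ c → ∀ j → j < 2 → Fr k (coeff Lᴾ j) ≈ coeff Lᴾ j
  Lᴾ-coefficients-fixed k Frₖc≈c zero    _ = trans (Fr-homo-‿ k c) (-‿cong Frₖc≈c)
  Lᴾ-coefficients-fixed k Frₖc≈c (suc j) _ = Fr-1# k

  L-preserves-kernel : ∀ x → T x ≈ 0# → T (L x) ≈ 0#
  L-preserves-kernel x Tx≈0 = begin
    T (L x)             ≈⟨ T-cong (⟦Lᴾ⟧≈L x) ⟨
    T (⟦ Lᴾ ⟧ x)        ≈⟨ ⟦Tᴾ⟧≈T _ ⟨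
    ⟦ Tᴾ ⟧ (⟦ Lᴾ ⟧ x)   ≈⟨ ⟦⟧-preserves-kernel Tᴾ Lᴾ x
                             (λ i j _ → Lᴾ-coefficients-fixed (i ℕ.* s) (c-fixed-by-s-multiples i) j)
                             (Tᴾ-coefficients-fixed Lᴾ) (trans (⟦Tᴾ⟧≈T x) Tx≈0) ⟩
    0#                  ∎

  T∘A≈A∘T : ∀ x → T (A x) ≈ A (T x)
  T∘A≈A∘T x = trans (sym (⟦Tᴾ⟧≈T _)) (trans (⟦⟧-comm Tᴾ Aᴾ x γ-fixed (Tᴾ-coefficients-fixed Aᴾ)) (A-cong (⟦Tᴾ⟧≈T x)))
    where
    γ-fixed : CoefficientsFixedBy Aᴾ Tᴾ
    γ-fixed i j _ _ = trans (Fr-pow (i ℕ.* s) u (E j))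
      (pow-congˡ (E j) (Fr-fixed-⁻¹ (i ℕ.* s) c c≉0 (c-fixed-by-s-multiples i)))

  A-preserves-kernel : ∀ x → T x ≈ 0# → T (A x) ≈ 0#
  A-preserves-kernel x Tx≈0 = trans (T∘A≈A∘T x) (trans (A-cong Tx≈0) (⟦⟧-0# Aᴾ))

  Gᴾ : Linearised
  Gᴾ = linearised (t ∸ 1) (λ i → t⁻¹ * natF F (suc i)) (λ i → (suc i ℕ.* s ℕ.* r) div d)

  ⟦Gᴾ⟧≈G : ∀ y → ⟦ Gᴾ ⟧ y ≈ G y
  ⟦Gᴾ⟧≈G y = trans (sumF-cong′ (t ∸ 1) (λ i → *-assoc _ _ _)) (sym (*-distribˡ-sumF (t ∸ 1) t⁻¹ _))

  module _ (t≉0 : ¬ (natF F t ≈ 0#)) where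

    Gᴾ-coefficients-fixed : ∀ P → CoefficientsFixedBy Gᴾ P
    Gᴾ-coefficients-fixed P i j _ _ =
      trans (Fr-homo-* (expo P i) _ _) (*-cong (Fr-fixed-⁻¹ (expo P i) _ t≉0 (Fr-natF (expo P i) t)) (Fr-natF (expo P i) (suc j)))

    G-preserves-kernel : ∀ y → T y ≈ 0# → T (G y) ≈ 0#
    G-preserves-kernel y Ty≈0 = begin
      T (G y)         ≈⟨ T-cong (⟦Gᴾ⟧≈G y) ⟨
      T (⟦ Gᴾ ⟧ y)        ≈⟨ ⟦Tᴾ⟧≈T _ ⟨
      ⟦ Tᴾ ⟧ (⟦ Gᴾ ⟧ y)   ≈⟨ ⟦⟧-preserves-kernel Tᴾ Gᴾ y (Gᴾ-coefficients-fixed Tᴾ) (Tᴾ-coefficients-fixed Gᴾ)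
                               (trans (⟦Tᴾ⟧≈T y) Ty≈0) ⟩
      0#                  ∎

    G∘L≈L∘G : ∀ y → G (L y) ≈ L (G y)
    G∘L≈L∘G y = begin
      G (L y)          ≈⟨ ⟦Gᴾ⟧≈G _ ⟨
      ⟦ Gᴾ ⟧ (L y)         ≈⟨ ⟦⟧-cong Gᴾ (⟦Lᴾ⟧≈L y) ⟨
      ⟦ Gᴾ ⟧ (⟦ Lᴾ ⟧ y)    ≈⟨ ⟦⟧-comm Gᴾ Lᴾ y (λ i j _ → Lᴾ-coefficients-fixed ((suc i ℕ.* s ℕ.* r) div d) (c-fixed-by-G-exponent i) j)
                                (Gᴾ-coefficients-fixed Lᴾ) ⟩
      ⟦ Lᴾ ⟧ (⟦ Gᴾ ⟧ y)    ≈⟨ ⟦Lᴾ⟧≈L _ ⟩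
      L (⟦ Gᴾ ⟧ y)         ≈⟨ L-cong (⟦Gᴾ⟧≈G y) ⟩
      L (G y)          ∎
      where
      c-fixed-by-G-exponent : ∀ i → Fr ((suc i ℕ.* s ℕ.* r) div d) c ≈ c
      c-fixed-by-G-exponent i = trans (reflexive (≡.cong (λ k → Fr k c) ([k*s*r]div-d≡k*[e*r] (suc i))))
        (trans (reflexive (≡.cong (λ k → Fr k c) (≡.trans (≡.cong (suc i ℕ.*_) e*r≡r′*s) (≡.sym (NP.*-assoc (suc i) r′ s)))))
               (c-fixed-by-s-multiples (suc i ℕ.* r′)))

    inverse-preserves-kernel : ∀ y → T y ≈ 0# → T (inverse y) ≈ 0#
    inverse-preserves-kernel y Ty≈0 = A-preserves-kernel (G y) (G-preserves-kernel y Ty≈0)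

    L∘inverse≈id : ∀ y → T y ≈ 0# → L (inverse y) ≈ y
    L∘inverse≈id y Ty≈0 = trans (L∘A≈Φ-id (G y)) (Φ∘G-G≈id t≉0 y Ty≈0)

    inverse∘L≈id : ∀ y → T y ≈ 0# → inverse (L y) ≈ y
    inverse∘L≈id y Ty≈0 = trans (A-cong (G∘L≈L∘G y)) (trans (A∘L≈Φ-id (G y)) (Φ∘G-G≈id t≉0 y Ty≈0))

    L-injective-on-kernel : ∀ x y → T x ≈ 0# → T y ≈ 0# → L x ≈ L y → x ≈ y
    L-injective-on-kernel x y Tx≈0 Ty≈0 Lx≈Ly = begin
      x              ≈⟨ inverse∘L≈id x Tx≈0 ⟨
      inverse (L x)  ≈⟨ inverse-cong Lx≈Ly ⟩
      inverse (L y)  ≈⟨ inverse∘L≈id y Ty≈0 ⟩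
      y              ∎

  T-values-fixed-by-s : ∀ w → Fr s (T w) ≈ T w
  T-values-fixed-by-s w = begin
    Fr s (T w)                               ≈⟨ Fr-sumF s t _ ⟩
    sumF F t (λ i → Fr s (Fr (i ℕ.* s) w))   ≈⟨ sumF-cong′ t (λ i → trans (Fr-∘ s (i ℕ.* s) w)
                                                  (reflexive (≡.cong (λ k → Fr k w) (NP.+-comm (i ℕ.* s) s)))) ⟩
    sumF F t (λ i → Fr (suc i ℕ.* s) w)      ≈⟨ sumF-rotate t (λ i → Fr (i ℕ.* s) w)
                                                  (trans (reflexive (≡.cong (λ k → Fr k w) (≡.sym n≡t*s)))
                                                         (trans (Fr-n w) (sym (Fr-zero w)))) ⟩
    T w                                      ∎

  exponent : ℕ → ℕ → ℕ
  exponent j i = (j ℕ.* r ℕ.+ i ℕ.* s) % n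

  Fr-[is+jr]≈pow : ∀ j i w → Fr (i ℕ.* s ℕ.+ j ℕ.* r) w ≈ pow F w (q ^ exponent j i)
  Fr-[is+jr]≈pow j i w = trans (reflexive (≡.cong (λ k → Fr k w) divmod)) (Fr-periodic n w (Fr-n w) (X / n) (X % n))
    where
    X = j ℕ.* r ℕ.+ i ℕ.* s
    divmod : i ℕ.* s ℕ.+ j ℕ.* r ≡ X / n ℕ.* n ℕ.+ X % n
    divmod = ≡.trans (NP.+-comm (i ℕ.* s) (j ℕ.* r)) (≡.trans (m≡m%n+[m/n]*n X n) (NP.+-comm (X % n) _))

  A∘T-coefficient : ℕ → Carrier
  A∘T-coefficient k = sumF F e (λ j → sumF F t (λ i → δ k (q ^ exponent j i) (γ j)))

  A∘T-as-polynomial : ∀ w → sumF F (q ^ n) (λ k → A∘T-coefficient k * pow F w k) ≈ A (T w)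
  A∘T-as-polynomial w = begin
    sumF F (q ^ n) (λ k → A∘T-coefficient k * pow F w k)
      ≈⟨ sumF-cong′ (q ^ n) (λ k → trans (*-comm _ _) (trans (*-distribˡ-sumF e _ _) (sumF-cong′ e (λ j →
           trans (*-distribˡ-sumF t _ _) (sumF-cong′ t (λ i → trans (*-comm _ _) (δ-*ʳ k (q ^ exponent j i) (γ j) (pow F w k)))))))) ⟩
    sumF F (q ^ n) (λ k → sumF F e (λ j → sumF F t (λ i → δ k (q ^ exponent j i) (γ j * pow F w k))))
      ≈⟨ sumF-comm (q ^ n) e _ ⟩
    sumF F e (λ j → sumF F (q ^ n) (λ k → sumF F t (λ i → δ k (q ^ exponent j i) (γ j * pow F w k))))
      ≈⟨ sumF-cong′ e (λ j → sumF-comm (q ^ n) t _) ⟩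
    sumF F e (λ j → sumF F t (λ i → sumF F (q ^ n) (λ k → δ k (q ^ exponent j i) (γ j * pow F w k))))
      ≈⟨ sumF-cong′ e (λ j → sumF-cong′ t (λ i →
           sumF-δ (q ^ n) (q ^ exponent j i) (λ k → γ j * pow F w k) (NP.^-monoʳ-< q q>1 (m%n<n _ n)))) ⟩
    sumF F e (λ j → sumF F t (λ i → γ j * pow F w (q ^ exponent j i)))
      ≈⟨ sumF-cong′ e (λ j → sumF-cong′ t (λ i → *-cong (sym (*-identityʳ (γ j))) (sym (Fr-[is+jr]≈pow j i w)))) ⟩
    sumF F e (λ j → sumF F t (λ i → γ j * 1# * Fr (i ℕ.* s ℕ.+ j ℕ.* r) w))
      ≈⟨ ⟦⟧-∘ Aᴾ Tᴾ w (Tᴾ-coefficients-fixed Aᴾ) ⟨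
    A (⟦ Tᴾ ⟧ w)
      ≈⟨ A-cong (⟦Tᴾ⟧≈T w) ⟩
    A (T w) ∎

  private
    q^k≢1 : ∀ k → k ≢ 0 → 1 ≢ q ^ k
    q^k≢1 zero    k≢0 _ = k≢0 ≡.refl
    q^k≢1 (suc k) _     = NP.<⇒≢ (q^k>1 (suc k) (ℕ.s≤s ℕ.z≤n))

    exponent-term : ∀ j i → j < e → i < t → δ 1 (q ^ exponent j i) (γ j) ≈ δ i 0 (δ j 0 (γ j))
    exponent-term zero zero _ _ =
      trans (reflexive (≡.cong (λ k → δ 1 (q ^ k) (γ 0)) (m<n⇒m%n≡m n≥1)))
            (trans (δ-≡ 1 (γ 0)) (sym (trans (δ-≡ 0 _) (δ-≡ 0 _))))
    exponent-term zero (suc i) _ i<t =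
      trans (δ-≢ 1 _ _ (q^k≢1 (exponent 0 (suc i))
                         (λ %≡0 → NP.1+n≢0 (i*s≡0[mod-n]⇒i≡0 (suc i) i<t (m%n≡0⇒n∣m _ n %≡0)))))
            (sym (δ-≢ (suc i) 0 (δ 0 0 (γ 0)) NP.1+n≢0))
    exponent-term (suc j) i j<e _ =
      trans (δ-≢ 1 _ _ (q^k≢1 (exponent (suc j) i)
                         (λ %≡0 → NP.1+n≢0 (j*r+i*s≡0[mod-n]⇒j≡0 (suc j) i j<e (m%n≡0⇒n∣m _ n %≡0)))))
            (sym (trans (δ-congʳ i 0 (δ-≢ (suc j) 0 (γ (suc j)) NP.1+n≢0)) (δ-0# i 0)))

  A∘T-coefficient[1]≈γ₀ : A∘T-coefficient 1 ≈ γ 0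
  A∘T-coefficient[1]≈γ₀ = begin
    A∘T-coefficient 1                                          ≈⟨ sumF-cong e (λ j j<e → sumF-cong t (λ i i<t → exponent-term j i j<e i<t)) ⟩
    sumF F e (λ j → sumF F t (λ i → δ i 0 (δ j 0 (γ j))))      ≈⟨ sumF-cong′ e (λ j → sumF-δ t 0 (λ _ → δ j 0 (γ j)) t>0) ⟩
    sumF F e (λ j → δ j 0 (γ j))                               ≈⟨ sumF-δ e 0 γ e>0 ⟩
    γ 0                                                        ∎

  γ₀≉0 : ¬ (γ 0 ≈ 0#)
  γ₀≉0 γ₀≈0 = ⁻¹-≉0 c c≉0 (trans (sym γ₀≈u) γ₀≈0)

  injective-on-kernel⇒t≉0 : (∀ x y → T x ≈ 0# → T y ≈ 0# → L x ≈ L y → x ≈ y) → ¬ (natF F t ≈ 0#)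
  injective-on-kernel⇒t≉0 L-injective t≈0 =
    γ₀≉0 (trans (sym A∘T-coefficient[1]≈γ₀)
      (vanishing-everywhere⇒≈0 A∘T-coefficient (λ w → trans (A∘T-as-polynomial w) (A∘T≈0 w)) 1 (q^k>1 n n≥1)))
    where
    A∘T≈0 : ∀ w → A (T w) ≈ 0#
    A∘T≈0 w = L-injective (A z) 0# TAz≈0 T0≈0 (begin
      L (A z)  ≈⟨ L∘A≈Φ-id z ⟩
      Φ z - z  ≈⟨ +-congʳ Φz≈z ⟩
      z - z    ≈⟨ -‿inverseʳ z ⟩
      0#       ≈⟨ L0≈0 ⟨
      L 0#     ∎)
      where
      z = T w
      Φz≈z : Φ z ≈ z
      Φz≈z = trans (reflexive (≡.cong (λ k → Fr k z) (≡.trans e*r≡r′*s (≡.sym (NP.+-identityʳ (r′ ℕ.* s))))))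
                   (trans (Fr-periodic s z (T-values-fixed-by-s w) r′ 0) (Fr-zero z))
      Tz≈0 : T z ≈ 0#
      Tz≈0 = trans (sumF-cong′ t (λ i → Fr-multiple s z (T-values-fixed-by-s w) i))
                   (trans (sumF-const t z) (trans (*-congʳ t≈0) (zeroˡ z)))
      TAz≈0 : T (A z) ≈ 0#
      TAz≈0 = A-preserves-kernel z Tz≈0
      T0≈0 : T 0# ≈ 0#
      T0≈0 = trans (sym (⟦Tᴾ⟧≈T 0#)) (⟦⟧-0# Tᴾ)
      L0≈0 : L 0# ≈ 0#
      L0≈0 = trans (sym (⟦Lᴾ⟧≈L 0#)) (⟦⟧-0# Lᴾ)

theorem2p4 : ∀ {a ℓ : Level} (p m n r s : ℕ) → Prime p → 1 ≤ m →
    1 ≤ n → 1 ≤ r → 1 ≤ s → s ∣ n → gcd n r ≡ gcd s r →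
    (F : FiniteField a ℓ ((p ^ m) ^ n)) →
    (c : FiniteField.Carrier F) →
    FiniteField._≈_ F (pow F c ((p ^ m) ^ s)) c →
    FiniteField._≈_ F (norm F (p ^ m) s (gcd n r) c) (FiniteField.1# F) →
    (PermutesOn F (Lbin F (p ^ m) r c) (InKer F (p ^ m) n s) ⇔ (¬ (p ∣ (n div s))))
    × (¬ (p ∣ (n div s)) → ∀ y → InKer F (p ^ m) n s y →
         InKer F (p ^ m) n s (invPoly F (p ^ m) n r s (gcd n r) c y)
         × FiniteField._≈_ F (Lbin F (p ^ m) r c (invPoly F (p ^ m) n r s (gcd n r) c y)) y
         × FiniteField._≈_ F (invPoly F (p ^ m) n r s (gcd n r) c (Lbin F (p ^ m) r c y)) y)
theorem2p4 p m n r s p-prime m≥1 n≥1 r≥1 s≥1 s∣n gcd≡ F c c-fixed norm≈1 =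
  mk⇔ permutes⇒p∤t p∤t⇒permutes , inverse-formula
  where
  open BinomialOnTraceKernel p m n r s p-prime m≥1 n≥1 r≥1 s≥1 s∣n gcd≡ F c c-fixed norm≈1
  open Exponents n r s n≥1 r≥1 s≥1 s∣n gcd≡ using (t)
  open FieldProperties F using (_≈_; 0#)
  open Frobenius p m n p-prime F using (q)
  open Characteristic p m n p-prime F using (p∣k⇒natF[k]≈0; natF[k]≈0⇒p∣k)

  p∤t⇒t≉0 : ¬ (p ∣ t) → ¬ (natF F t ≈ 0#)
  p∤t⇒t≉0 p∤t t≈0 = p∤t (natF[k]≈0⇒p∣k t t≈0)

  permutes⇒p∤t : PermutesOn F L (InKer F q n s) → ¬ (p ∣ t)
  permutes⇒p∤t (_ , L-injective , _) p∣t = injective-on-kernel⇒t≉0 L-injective (p∣k⇒natF[k]≈0 t p∣t)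

  p∤t⇒permutes : ¬ (p ∣ t) → PermutesOn F L (InKer F q n s)
  p∤t⇒permutes p∤t = L-preserves-kernel , L-injective-on-kernel t≉0 ,
    λ y Ty≈0 → inverse y , inverse-preserves-kernel t≉0 y Ty≈0 , L∘inverse≈id t≉0 y Ty≈0
    where t≉0 = p∤t⇒t≉0 p∤t

  inverse-formula : ¬ (p ∣ t) → ∀ y → T y ≈ 0# → T (inverse y) ≈ 0# × L (inverse y) ≈ y × inverse (L y) ≈ y
  inverse-formula p∤t y Ty≈0 =
    inverse-preserves-kernel t≉0 y Ty≈0 , L∘inverse≈id t≉0 y Ty≈0 , inverse∘L≈id t≉0 y Ty≈0
    where t≉0 = p∤t⇒t≉0 p∤t
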